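{- Let $n,m$ be integers with $1\le m\le n-2$ and let $G$ be a connected simple graph on $n$ vertices with vertex $2$-partiteness $v_2(G)\le m$. (1) If $n-m$ is even, then $RDD(G)\le\frac{3n^3-m^3-3m^2n+9mn^2-2n^2+2m^2-16mn+8m}{8}$, with equality if and only if $G\cong K_m\vee\big(\overline{K_{(n-m)/2}}\vee\overline{K_{(n-m)/2}}\big)$. (2) If $n-m$ is odd, then $RDD(G)\le\frac{3n^3-m^3-3m^2n+9mn^2-2n^2+2m^2-16mn-3n+5m+2}{8}$, with equality if and only if $G\cong K_m\vee\big(\overline{K_{(n-m+1)/2}}\vee\overline{K_{(n-m-1)/2}}\big)$.
   Context: The vertex $2$-partiteness $v_2(G)$ is the minimum number of vertices whose deletion from $G$ yields a bipartite graph (parts possibly empty). With $d(x)$ the degree and $d(x,y)$ the shortest-path distance, $RDD(G)=\sum_{\{x,y\}\subseteq V(G)}\frac{d(x)+d(y)}{d(x,y)}$ over unordered pairs of distinct vertices. $G_1\vee G_2$ is the join; $\overline{K_r}$ is the edgeless graph on $r$ vertices; $K_m$ the complete graph. -}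

module Defs where

open import Data.Bool using (Bool; true; false; _∧_; _∨_; not; if_then_else_; T)
open import Data.Nat as ℕ using (ℕ; zero; suc; _<ᵇ_; _∸_)
open import Data.Fin using (Fin; toℕ)
open import Data.Fin.Properties using (_≟_)
open import Data.List using (List; map; foldr; allFin; filter)
open import Data.Integer as ℤ using (ℤ; +_)
open import Data.Rational as ℚ using (ℚ; _/_)
open import Data.Product using (Σ; _×_; ∃)
open import Relation.Nullary.Decidable using (⌊_⌋)
open import Relation.Binary.PropositionalEquality using (_≡_; _≢_)
open import Data.Fin.Subset using (Subset; _∉_; ∣_∣)

record Graph (n : ℕ) : Set where
  field
    adj    : Fin n → Fin n → Bool
    sym    : ∀ x y → adj x y ≡ adj y x
    irrefl : ∀ x → adj x x ≡ false
open Graph public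

data Walk {n : ℕ} (G : Graph n) : Fin n → Fin n → Set where
  [] : ∀ {x} → Walk G x x
  _∷_ : ∀ {x y z} → T (adj G x y) → Walk G y z → Walk G x z

Connected : ∀ {n} → Graph n → Set
Connected G = ∀ x y → Walk G x y

degree : ∀ {n} → Graph n → Fin n → ℕ
degree {n} G x = foldr ℕ._+_ 0 (map (λ y → if adj G x y then 1 else 0) (allFin n))

anyFin : ∀ {n} → (Fin n → Bool) → Bool
anyFin {n} p = foldr _∨_ false (map p (allFin n))

within : ∀ {n} → Graph n → ℕ → Fin n → Fin n → Bool
within G zero x y = ⌊ x ≟ y ⌋
within G (suc k) x y = within G k x y ∨ anyFin (λ z → adj G x z ∧ within G k z y)

-- least k ≤ bound with within k x y (returns bound if none found)
searchDist : ∀ {n} → Graph n → Fin n → Fin n → ℕ → ℕ → ℕ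
searchDist G x y k zero = k
searchDist G x y k (suc fuel) =
  if within G k x y then k else searchDist G x y (suc k) fuel

-- shortest-path distance d(x,y); in a connected graph on n vertices
-- every distance is ≤ n - 1, so searching k = 0 .. n suffices.
dist : ∀ {n} → Graph n → Fin n → Fin n → ℕ
dist {n} G x y = searchDist G x y 0 n

-- a / d as a rational, with the (never used for distinct vertices of a
-- connected graph) convention a / 0 = 0
frac : ℕ → ℕ → ℚ
frac a zero = ℚ.0ℚ
frac a (suc k) = (+ a) / suc k

sumℚ : List ℚ → ℚ
sumℚ = foldr ℚ._+_ ℚ.0ℚ

-- RDD(G) = Σ over unordered pairs {x,y}, x ≠ y, of (d(x)+d(y)) / d(x,y);
-- unordered pairs are enumerated as x < y.
RDD : ∀ {n} → Graph n → ℚ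
RDD {n} G = sumℚ (map (λ x → sumℚ (map (λ y →
    if toℕ x <ᵇ toℕ y
    then frac (degree G x ℕ.+ degree G y) (dist G x y)
    else ℚ.0ℚ) (allFin n))) (allFin n))

-- v₂(G) ≤ m : some set S of at most m vertices whose deletion leaves a
-- bipartite graph (a proper 2-colouring of G - S).
v₂≤ : ∀ {n} → Graph n → ℕ → Set
v₂≤ {n} G m = Σ (Subset n) λ S → (∣ S ∣ ℕ.≤ m) × Σ (Fin n → Bool) λ c →
  ∀ x y → x ∉ S → y ∉ S → T (adj G x y) → c x ≢ c y

record _≅_ {n : ℕ} (G H : Graph n) : Set where
  field
    to      : Fin n → Fin n
    from    : Fin n → Fin n
    from-to : ∀ x → from (to x) ≡ x
    to-from : ∀ y → to (from y) ≡ y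
    pres    : ∀ x y → adj G x y ≡ adj H (to x) (to y)

-- K_m ∨ (K̄_a ∨ K̄_b) on vertex set Fin n (n = m + a + b intended):
-- vertices with index < m form the K_m, indices in [m, m+a) the K̄_a,
-- the rest the K̄_b.
cls : ℕ → ℕ → ℕ → ℕ
cls m a i = if i <ᵇ m then 0 else (if i <ᵇ m ℕ.+ a then 1 else 2)

-- distinct vertices in classes c, d are adjacent unless they lie in the
-- same independent class (class 1 or 2); class 0 is the clique K_m
crossAdj : ℕ → ℕ → Bool
crossAdj c d = not (⌊ c ℕ.≟ d ⌋ ∧ not ⌊ c ℕ.≟ 0 ⌋)

joinAdj : ∀ {n} → ℕ → ℕ → Fin n → Fin n → Bool
joinAdj m a x y = not ⌊ x ≟ y ⌋ ∧ crossAdj (cls m a (toℕ x)) (cls m a (toℕ y))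


open import Relation.Nullary using (yes; no)
open import Relation.Binary.PropositionalEquality using (refl) renaming (sym to ≡sym)
open import Data.Empty using (⊥-elim)

private
  ⌊≟⌋-sym : ∀ {n} (x y : Fin n) → ⌊ x ≟ y ⌋ ≡ ⌊ y ≟ x ⌋
  ⌊≟⌋-sym x y with x ≟ y | y ≟ x
  ... | yes _ | yes _ = refl
  ... | no _ | no _ = refl
  ... | yes p | no q = ⊥-elim (q (≡sym p))
  ... | no p | yes q = ⊥-elim (p (≡sym q))

  ⌊ℕ≟⌋-sym : (x y : ℕ) → ⌊ x ℕ.≟ y ⌋ ≡ ⌊ y ℕ.≟ x ⌋
  ⌊ℕ≟⌋-sym x y with x ℕ.≟ y | y ℕ.≟ x
  ... | yes _ | yes _ = refl
  ... | no _ | no _ = refl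
  ... | yes p | no q = ⊥-elim (q (≡sym p))
  ... | no p | yes q = ⊥-elim (p (≡sym q))

  joinAdj-sym : ∀ {n} m a (x y : Fin n) → joinAdj m a x y ≡ joinAdj m a y x
  crossAdj-sym : ∀ c d → crossAdj c d ≡ crossAdj d c
  crossAdj-sym c d rewrite ⌊ℕ≟⌋-sym c d with d ℕ.≟ c
  ... | yes refl = refl
  ... | no _ = refl

  joinAdj-sym m a x y rewrite ⌊≟⌋-sym x y | crossAdj-sym (cls m a (toℕ x)) (cls m a (toℕ y)) = refl

  joinAdj-irrefl : ∀ {n} m a (x : Fin n) → joinAdj m a x x ≡ false
  joinAdj-irrefl m a x with x ≟ x
  ... | yes _ = refl
  ... | no ¬p = ⊥-elim (¬p refl)

joinGraph : (n m a : ℕ) → Graph n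
joinGraph n m a = record
  { adj = joinAdj m a
  ; sym = joinAdj-sym m a
  ; irrefl = joinAdj-irrefl m a }

boundEven : ℕ → ℕ → ℚ
boundEven n' m' =
  (+ 3 ℤ.* n ℤ.* n ℤ.* n ℤ.- m ℤ.* m ℤ.* m ℤ.- + 3 ℤ.* m ℤ.* m ℤ.* n
   ℤ.+ + 9 ℤ.* m ℤ.* n ℤ.* n ℤ.- + 2 ℤ.* n ℤ.* n ℤ.+ + 2 ℤ.* m ℤ.* m
   ℤ.- + 16 ℤ.* m ℤ.* n ℤ.+ + 8 ℤ.* m) / 8
  where n m : ℤ
        n = + n'
        m = + m'

boundOdd : ℕ → ℕ → ℚ
boundOdd n' m' =
  (+ 3 ℤ.* n ℤ.* n ℤ.* n ℤ.- m ℤ.* m ℤ.* m ℤ.- + 3 ℤ.* m ℤ.* m ℤ.* n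
   ℤ.+ + 9 ℤ.* m ℤ.* n ℤ.* n ℤ.- + 2 ℤ.* n ℤ.* n ℤ.+ + 2 ℤ.* m ℤ.* m
   ℤ.- + 16 ℤ.* m ℤ.* n ℤ.- + 3 ℤ.* n ℤ.+ + 5 ℤ.* m ℤ.+ + 2) / 8
  where n m : ℤ
        n = + n'
        m = + m'

-- Let W(G) = Σ_{x<y} (d(x)+d(y))(1+[x~y]).  Termwise
-- (d(x)+d(y))/d(x,y) ≤ (d(x)+d(y))(1+[x~y])/2, with equality at distances
-- 1 and 2, so 2·RDD(G) ≤ W(G), sharp for diameter ≤ 2.  By the closed form
-- W = Σ_x d(x)(n-1) + d(x)², W strictly grows as edges are added.  A
-- deletion set S with a 2-colouring of G - S puts G inside the three-class
-- graph K_s ∨ (K̄_a ∨ K̄_b), s = |S| ≤ m, a ≥ b, whose W is a cubic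
-- F(s,a,b).  Integer polynomial identities give 8·bound = 4F + X with
-- X ≥ 0, and X = 0 only for s = m and the balanced a (`SharpNumerator`).
-- Hence RDD ≤ W/2 ≤ F/2 ≤ bound, and equality forces G to be the full
-- three-class graph of the extremal sizes, i.e. the join graph; conversely
-- the join graph has diameter 2 and attains the bound (`sharp-bound`).

module Submission where

open import Defs hiding (sym)
import Algebra.Properties.Semiring.Sum as FinSum
open import Data.Bool using (Bool; true; false; _∧_; _∨_; not; if_then_else_; T)
open import Data.Bool.Properties using (∨-zeroʳ; ∧-identityʳ; ∧-zeroʳ)
open import Data.Empty using (⊥-elim)
open import Data.Fin using (Fin; toℕ; punchIn; #_) renaming (zero to fzero; suc to fsuc)
open import Data.Fin.Permutation as Perm using (Permutation′; _⟨$⟩ʳ_; _⟨$⟩ˡ_; insert; insert-punchIn; permutation)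
open import Data.Fin.Properties using (_≟_; toℕ-injective; punchInᵢ≢i)
open import Data.Fin.Subset using (Subset; ∣_∣; _∉_)
open import Data.Integer as ℤ using (ℤ; +_; +≤+)
import Data.Integer.Properties as ℤP
import Data.Integer.Tactic.RingSolver as ℤRing
open import Data.List using ([]; _∷_; map; foldr; allFin; tabulate)
open import Data.List.Membership.Propositional using (_∈_)
open import Data.List.Membership.Propositional.Properties using (∈-allFin)
open import Data.List.Properties using (map-tabulate; map-cong)
open import Data.List.Relation.Unary.Any using (here; there)
open import Data.Nat as ℕ using (ℕ; zero; suc; _+_; _*_; _∸_; _<ᵇ_; _≤_; _<_; z≤n; s≤s; _%_; _/_)
import Data.Nat.DivMod as ℕDM
import Data.Nat.Properties as ℕP
import Data.Nat.Tactic.RingSolver as ℕRing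
open import Data.Product using (Σ; _,_; _×_; proj₁; proj₂)
open import Data.Rational as ℚ using (ℚ) renaming (_≤_ to _≤ℚ_)
import Data.Rational.Properties as ℚP
open import Data.Rational.Unnormalised using (mkℚᵘ; *≤*; *≡*)
import Data.Rational.Unnormalised.Properties as ℚᵘP
open import Data.Sum using (_⊎_; inj₁; inj₂)
open import Data.Unit using (tt)
open import Data.Vec using ([]; _∷_; lookup)
open import Data.Vec.Properties using ([]=⇒lookup)
open import Function using (_∘_)
open import Function.Bundles using (_⇔_; mk⇔)
open import Relation.Binary.PropositionalEquality
open import Relation.Nullary using (yes; no; Dec)
open import Relation.Nullary.Decidable using (⌊_⌋)

module ℕΣ = FinSum ℕP.+-*-semiring
open ℕΣ using (sum; sum-cong-≗; ∑-distrib-+; ∑-comm; sum-remove; *-distribʳ-sum; sum-permute)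

𝟙 : Bool → ℕ
𝟙 b = if b then 1 else 0

listSum≡sum : ∀ {n} (f : Fin n → ℕ) → foldr _+_ 0 (map f (allFin n)) ≡ sum f
listSum≡sum {n} f = trans (cong (foldr _+_ 0) (map-tabulate {n = n} (λ x → x) f)) (tabulated n f)
  where
  tabulated : ∀ k (g : Fin k → ℕ) → foldr _+_ 0 (tabulate g) ≡ sum g
  tabulated zero g = refl
  tabulated (suc k) g = cong (λ r → g fzero + r) (tabulated k (g ∘ fsuc))

deg : ∀ {n} → (Fin n → Fin n → Bool) → Fin n → ℕ
deg A x = sum (λ y → 𝟙 (A x y))

degree≡deg : ∀ {n} (G : Graph n) x → degree G x ≡ deg (adj G) x
degree≡deg G x = listSum≡sum (λ y → 𝟙 (adj G x y))

or-witness : ∀ {A : Set} (p : A → Bool) {xs z} → z ∈ xs → p z ≡ true → foldr _∨_ false (map p xs) ≡ true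
or-witness p (here refl) pz rewrite pz = refl
or-witness p {x ∷ _} (there z∈xs) pz = trans (cong (p x ∨_) (or-witness p z∈xs pz)) (∨-zeroʳ (p x))

or-none : ∀ {A : Set} (p : A → Bool) xs → (∀ z → p z ≡ false) → foldr _∨_ false (map p xs) ≡ false
or-none p [] none = refl
or-none p (x ∷ xs) none rewrite none x = or-none p xs none

module Distances {n} (G : Graph n) where

  within-0 : ∀ {x y} → x ≢ y → within G 0 x y ≡ false
  within-0 {x} {y} x≢y with x ≟ y
  ... | yes x≡y = ⊥-elim (x≢y x≡y)
  ... | no _ = refl

  within-1-adj : ∀ {x y} → adj G x y ≡ true → within G 1 x y ≡ true
  within-1-adj {x} {y} xy with within G 0 x y
  ... | true = refl
  ... | false = or-witness _ (∈-allFin y) step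
    where
    step : (adj G x y ∧ ⌊ y ≟ y ⌋) ≡ true
    step with y ≟ y
    ... | yes _ = trans (∧-identityʳ (adj G x y)) xy
    ... | no y≢y = ⊥-elim (y≢y refl)

  within-1-nonadj : ∀ {x y} → x ≢ y → adj G x y ≡ false → within G 1 x y ≡ false
  within-1-nonadj {x} {y} x≢y xy rewrite within-0 x≢y = or-none _ (allFin n) step
    where
    step : ∀ z → (adj G x z ∧ ⌊ z ≟ y ⌋) ≡ false
    step z with z ≟ y
    ... | yes refl = trans (∧-identityʳ (adj G x z)) xy
    ... | no _ = ∧-zeroʳ (adj G x z)

  within-2 : ∀ {x y} z → adj G x z ≡ true → adj G z y ≡ true → within G 2 x y ≡ true
  within-2 {x} {y} z xz zy with within G 1 x y
  ... | true = refl
  ... | false = or-witness _ (∈-allFin z)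
      (trans (cong (adj G x z ∧_) (within-1-adj zy)) (trans (∧-identityʳ _) xz))

  search-≥ : ∀ x y k fuel → k ≤ searchDist G x y k fuel
  search-≥ x y k zero = ℕP.≤-refl
  search-≥ x y k (suc fuel) with within G k x y
  ... | true = ℕP.≤-refl
  ... | false = ℕP.≤-trans (ℕP.n≤1+n k) (search-≥ x y (suc k) fuel)

  search-hit : ∀ x y k fuel → within G k x y ≡ true → searchDist G x y k (suc fuel) ≡ k
  search-hit x y k fuel w rewrite w = refl

  search-miss : ∀ x y k fuel → within G k x y ≡ false →
    searchDist G x y k (suc fuel) ≡ searchDist G x y (suc k) fuel
  search-miss x y k fuel w rewrite w = refl

open Distances

dist-adj : ∀ {n} (G : Graph n) {x y} → x ≢ y → adj G x y ≡ true → dist G x y ≡ 1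
dist-adj {suc zero} G {fzero} {fzero} x≢y _ = ⊥-elim (x≢y refl)
dist-adj {suc (suc k)} G {x} {y} x≢y xy =
  trans (search-miss G x y 0 (suc k) (within-0 G x≢y)) (search-hit G x y 1 k (within-1-adj G xy))

dist-nonadj : ∀ {n} (G : Graph n) {x y} → x ≢ y → adj G x y ≡ false → 2 ≤ dist G x y
dist-nonadj {suc zero} G {fzero} {fzero} x≢y _ = ⊥-elim (x≢y refl)
dist-nonadj {suc (suc k)} G {x} {y} x≢y xy =
  subst (2 ≤_) (sym (trans (search-miss G x y 0 (suc k) (within-0 G x≢y)) (search-miss G x y 1 k (within-1-nonadj G x≢y xy))))
    (search-≥ G x y 2 k)

dist-common : ∀ {n} (G : Graph n) {x y} z → x ≢ y → adj G x y ≡ false →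
  adj G x z ≡ true → adj G z y ≡ true → dist G x y ≡ 2
dist-common {suc zero} G {fzero} {fzero} z x≢y _ _ _ = ⊥-elim (x≢y refl)
dist-common {suc (suc zero)} G {x} {y} z x≢y xy _ _ =
  trans (search-miss G x y 0 1 (within-0 G x≢y)) (search-miss G x y 1 0 (within-1-nonadj G x≢y xy))
dist-common {suc (suc (suc k))} G {x} {y} z x≢y xy xz zy =
  trans (search-miss G x y 0 (suc (suc k)) (within-0 G x≢y))
    (trans (search-miss G x y 1 (suc k) (within-1-nonadj G x≢y xy)) (search-hit G x y 2 k (within-2 G z xz zy)))

half : ℕ → ℚ
half k = + k ℚ./ 2

/-mono-≤ : ∀ p q r s → p ℤ.* + suc s ℤ.≤ r ℤ.* + suc q → p ℚ./ suc q ≤ℚ r ℚ./ suc s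
/-mono-≤ p q r s le = ℚP.toℚᵘ-cancel-≤
  (ℚᵘP.≤-respʳ-≃ (ℚᵘP.≃-sym (ℚP.toℚᵘ-fromℚᵘ (mkℚᵘ r s)))
    (ℚᵘP.≤-respˡ-≃ (ℚᵘP.≃-sym (ℚP.toℚᵘ-fromℚᵘ (mkℚᵘ p q))) (*≤* le)))

/-cancel-≤ : ∀ p q r s → p ℚ./ suc q ≤ℚ r ℚ./ suc s → p ℤ.* + suc s ℤ.≤ r ℤ.* + suc q
/-cancel-≤ p q r s le with ℚᵘP.≤-respʳ-≃ (ℚP.toℚᵘ-fromℚᵘ (mkℚᵘ r s))
                          (ℚᵘP.≤-respˡ-≃ (ℚP.toℚᵘ-fromℚᵘ (mkℚᵘ p q)) (ℚP.toℚᵘ-mono-≤ le))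
... | *≤* cross = cross

/-cong-cross : ∀ p q r s → p ℤ.* + suc s ≡ r ℤ.* + suc q → p ℚ./ suc q ≡ r ℚ./ suc s
/-cong-cross p q r s cross = ℚP.fromℚᵘ-cong {mkℚᵘ p q} {mkℚᵘ r s} (*≡* cross)

frac≤half : ∀ a k w → a * 2 ≤ w * suc k → frac a (suc k) ≤ℚ half w
frac≤half a k w le = /-mono-≤ (+ a) k (+ w) 1
  (subst₂ ℤ._≤_ (ℤP.pos-* a 2) (ℤP.pos-* w (suc k)) (+≤+ le))

frac≡half : ∀ a k w → a * 2 ≡ w * suc k → frac a (suc k) ≡ half w
frac≡half a k w eq = /-cong-cross (+ a) k (+ w) 1
  (trans (sym (ℤP.pos-* a 2)) (trans (cong +_ eq) (ℤP.pos-* w (suc k))))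

half-+ : ∀ a b → half a ℚ.+ half b ≡ half (a + b)
half-+ a b = ℚP.toℚᵘ-injective
  (ℚᵘP.≃-trans (ℚP.toℚᵘ-homo-+ (half a) (half b))
  (ℚᵘP.≃-trans (ℚᵘP.+-cong (ℚP.toℚᵘ-fromℚᵘ (mkℚᵘ (+ a) 1)) (ℚP.toℚᵘ-fromℚᵘ (mkℚᵘ (+ b) 1)))
  (ℚᵘP.≃-trans (*≡* cross) (ℚᵘP.≃-sym (ℚP.toℚᵘ-fromℚᵘ (mkℚᵘ (+ (a + b)) 1))))))
  where
  cross : (+ a ℤ.* + 2 ℤ.+ + b ℤ.* + 2) ℤ.* + 2 ≡ + (a + b) ℤ.* (+ 2 ℤ.* + 2)
  cross rewrite ℤP.pos-+ a b = regroup (+ a) (+ b)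
    where
    regroup : ∀ x y → (x ℤ.* + 2 ℤ.+ y ℤ.* + 2) ℤ.* + 2 ≡ (x ℤ.+ y) ℤ.* (+ 2 ℤ.* + 2)
    regroup = ℤRing.solve-∀

sumℚ-mono : ∀ {A : Set} {f g : A → ℚ} xs → (∀ x → f x ≤ℚ g x) → sumℚ (map f xs) ≤ℚ sumℚ (map g xs)
sumℚ-mono [] f≤g = ℚP.≤-refl
sumℚ-mono (x ∷ xs) f≤g = ℚP.+-mono-≤ (f≤g x) (sumℚ-mono xs f≤g)

sumℚ-half : ∀ {A : Set} (f : A → ℕ) xs → sumℚ (map (half ∘ f) xs) ≡ half (foldr _+_ 0 (map f xs))
sumℚ-half f [] = refl
sumℚ-half f (x ∷ xs) = trans (cong (half (f x) ℚ.+_) (sumℚ-half f xs)) (half-+ (f x) _)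

rddTerm : ∀ {n} → Graph n → Fin n → Fin n → ℚ
rddTerm G x y = if toℕ x <ᵇ toℕ y then frac (degree G x + degree G y) (dist G x y) else ℚ.0ℚ

pairWeight : ∀ {n} → (Fin n → Fin n → Bool) → Fin n → Fin n → ℕ
pairWeight A x y = if toℕ x <ᵇ toℕ y then (deg A x + deg A y) * (1 + 𝟙 (A x y)) else 0

W : ∀ {n} → (Fin n → Fin n → Bool) → ℕ
W A = sum (λ x → sum (λ y → pairWeight A x y))

-- Any two distinct non-adjacent vertices have a common neighbour, i.e. the
-- diameter is at most 2; exactly then the estimate 2·RDD ≤ W is sharp.
CommonNeighbours : ∀ {n} → Graph n → Set
CommonNeighbours {n} G =
  ∀ x y → x ≢ y → adj G x y ≡ false → Σ (Fin n) λ z → adj G x z ≡ true × adj G z y ≡ true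

<ᵇ-irrefl : ∀ k → (k <ᵇ k) ≡ false
<ᵇ-irrefl zero = refl
<ᵇ-irrefl (suc k) = <ᵇ-irrefl k

<ᵇ⇒≢ : ∀ {n} {x y : Fin n} → (toℕ x <ᵇ toℕ y) ≡ true → x ≢ y
<ᵇ⇒≢ {x = x} x<y refl with trans (sym x<y) (<ᵇ-irrefl (toℕ x))
... | ()

-- For x < y: an edge contributes (d(x)+d(y))/1 = 2(d(x)+d(y))/2, a non-edge
-- (d(x)+d(y))/d(x,y) ≤ (d(x)+d(y))/2, with equality at distance 2.
rddTerm≤ : ∀ {n} (G : Graph n) x y → rddTerm G x y ≤ℚ half (pairWeight (adj G) x y)
rddTerm≤ G x y with toℕ x <ᵇ toℕ y in x<y
... | false = ℚP.≤-refl
... | true rewrite degree≡deg G x | degree≡deg G y with adj G x y in xy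
...   | true rewrite dist-adj G (<ᵇ⇒≢ x<y) xy = frac≤half a 0 (a * 2) (ℕP.≤-reflexive (sym (ℕP.*-identityʳ (a * 2))))
  where a = deg (adj G) x + deg (adj G) y
...   | false with dist G x y | dist-nonadj G (<ᵇ⇒≢ x<y) xy
...     | suc zero | s≤s ()
...     | suc (suc k) | _ = frac≤half a (suc k) (a * 1)
          (subst (λ r → a * 2 ≤ r * suc (suc k)) (sym (ℕP.*-identityʳ a)) (ℕP.*-monoʳ-≤ a (s≤s (s≤s z≤n))))
  where a = deg (adj G) x + deg (adj G) y

rddTerm≡ : ∀ {n} (G : Graph n) → CommonNeighbours G → ∀ x y → rddTerm G x y ≡ half (pairWeight (adj G) x y)
rddTerm≡ G common x y with toℕ x <ᵇ toℕ y in x<y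
... | false = refl
... | true rewrite degree≡deg G x | degree≡deg G y with adj G x y in xy
...   | true rewrite dist-adj G (<ᵇ⇒≢ x<y) xy = frac≡half a 0 (a * 2) (sym (ℕP.*-identityʳ (a * 2)))
  where a = deg (adj G) x + deg (adj G) y
...   | false with common x y (<ᵇ⇒≢ x<y) xy
...     | z , xz , zy rewrite dist-common G z (<ᵇ⇒≢ x<y) xy xz zy =
          frac≡half a 1 (a * 1) (cong (_* 2) (sym (ℕP.*-identityʳ a)))
  where a = deg (adj G) x + deg (adj G) y

sum-halves : ∀ {n} (A : Fin n → Fin n → Bool) →
  sumℚ (map (λ x → sumℚ (map (λ y → half (pairWeight A x y)) (allFin n))) (allFin n)) ≡ half (W A)
sum-halves {n} A = begin
  sumℚ (map (λ x → sumℚ (map (half ∘ pairWeight A x) (allFin n))) (allFin n))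
    ≡⟨ cong sumℚ (map-cong (λ x → sumℚ-half (pairWeight A x) (allFin n)) (allFin n)) ⟩
  sumℚ (map (half ∘ (λ x → foldr _+_ 0 (map (pairWeight A x) (allFin n)))) (allFin n))
    ≡⟨ sumℚ-half _ (allFin n) ⟩
  half (foldr _+_ 0 (map (λ x → foldr _+_ 0 (map (pairWeight A x) (allFin n))) (allFin n)))
    ≡⟨ cong half (trans (cong (foldr _+_ 0) (map-cong (λ x → listSum≡sum (pairWeight A x)) (allFin n)))
                        (listSum≡sum (λ x → sum (pairWeight A x)))) ⟩
  half (W A) ∎
  where open ≡-Reasoning

RDD≤halfW : ∀ {n} (G : Graph n) → RDD G ≤ℚ half (W (adj G))
RDD≤halfW {n} G = subst (RDD G ≤ℚ_) (sum-halves (adj G))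
  (sumℚ-mono (allFin n) (λ x → sumℚ-mono (allFin n) (rddTerm≤ G x)))

RDD≡halfW : ∀ {n} (G : Graph n) → CommonNeighbours G → RDD G ≡ half (W (adj G))
RDD≡halfW {n} G common = trans
  (cong sumℚ (map-cong (λ x → cong sumℚ (map-cong (rddTerm≡ G common x) (allFin n))) (allFin n)))
  (sum-halves (adj G))

distinct-sym : ∀ {n} (x y : Fin n) → not ⌊ x ≟ y ⌋ ≡ not ⌊ y ≟ x ⌋
distinct-sym x y with x ≟ y | y ≟ x
... | yes _ | yes _ = refl
... | no _ | no _ = refl
... | yes x≡y | no y≢x = ⊥-elim (y≢x (sym x≡y))
... | no x≢y | yes y≡x = ⊥-elim (x≢y (sym y≡x))

distinct-≢ : ∀ {n} {x y : Fin n} → x ≢ y → not ⌊ x ≟ y ⌋ ≡ true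
distinct-≢ {x = x} {y} x≢y with x ≟ y
... | yes x≡y = ⊥-elim (x≢y x≡y)
... | no _ = refl

offDiag : ∀ {n} → Fin n → Fin n → ℕ
offDiag x y = 𝟙 (not ⌊ x ≟ y ⌋)

below : ∀ {n} → Fin n → Fin n → ℕ
below x y = 𝟙 (toℕ x <ᵇ toℕ y)

offDiag-sym : ∀ {n} (x y : Fin n) → offDiag x y ≡ offDiag y x
offDiag-sym x y = cong 𝟙 (distinct-sym x y)

below-split : ∀ {n} (x y : Fin n) → below x y + below y x ≡ offDiag x y
below-split x y with x ≟ y
... | yes refl rewrite <ᵇ-irrefl (toℕ x) = refl
... | no x≢y = trichotomy (toℕ x) (toℕ y) (x≢y ∘ toℕ-injective)
  where
  trichotomy : ∀ a b → a ≢ b → 𝟙 (a <ᵇ b) + 𝟙 (b <ᵇ a) ≡ 1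
  trichotomy zero zero a≢b = ⊥-elim (a≢b refl)
  trichotomy zero (suc b) _ = refl
  trichotomy (suc a) zero _ = refl
  trichotomy (suc a) (suc b) a≢b = trichotomy a b (a≢b ∘ cong suc)

offDiag-≢ : ∀ {n} {x y : Fin n} → x ≢ y → offDiag x y ≡ 1
offDiag-≢ x≢y = cong 𝟙 (distinct-≢ x≢y)

ordered : ∀ {n} {x y : Fin n} → x ≢ y → (toℕ x <ᵇ toℕ y) ≡ true ⊎ (toℕ y <ᵇ toℕ x) ≡ true
ordered {x = x} {y} x≢y with toℕ x <ᵇ toℕ y in x<y | toℕ y <ᵇ toℕ x in y<x
... | true | _ = inj₁ refl
... | false | true = inj₂ refl
... | false | false with () ← trans (cong₂ (λ p q → 𝟙 p + 𝟙 q) (sym x<y) (sym y<x))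
                                   (trans (below-split x y) (offDiag-≢ x≢y))

sum-ones : ∀ k → sum {k} (λ _ → 1) ≡ k
sum-ones zero = refl
sum-ones (suc k) = cong suc (sum-ones k)

offDiag-row : ∀ {n} (x : Fin n) → sum (offDiag x) ≡ n ∸ 1
offDiag-row {suc n} x = trans (sum-remove {i = x} (offDiag x)) (cong₂ _+_ self (trans (sum-cong-≗ others) (sum-ones n)))
  where
  self : offDiag x x ≡ 0
  self with x ≟ x
  ... | yes _ = refl
  ... | no x≢x = ⊥-elim (x≢x refl)
  others : ∀ j → offDiag x (punchIn x j) ≡ 1
  others j = offDiag-≢ (λ x≡ → punchInᵢ≢i x j (sym x≡))

ordered-pairs : ∀ {n} (H : Fin n → Fin n → ℕ) → (∀ x y → H x y ≡ H y x) →
  2 * sum (λ x → sum (λ y → below x y * H x y)) ≡ sum (λ x → sum (λ y → offDiag x y * H x y))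
ordered-pairs {n} H H-sym = begin
  2 * S                                                               ≡⟨ cong (λ r → S + r) (ℕP.+-identityʳ S) ⟩
  S + S                                                               ≡⟨ cong (λ r → S + r) (∑-comm (λ x y → below x y * H x y)) ⟩
  S + sum (λ x → sum (λ y → below y x * H y x))                       ≡⟨ cong (λ r → S + r) (sum-cong-≗ λ x → sum-cong-≗ λ y → cong (below y x *_) (H-sym y x)) ⟩
  S + sum (λ x → sum (λ y → below y x * H x y))                       ≡⟨ sym (∑-distrib-+ (λ x → sum (λ y → below x y * H x y)) _) ⟩
  sum (λ x → sum (λ y → below x y * H x y) + sum (λ y → below y x * H x y)) ≡⟨ sum-cong-≗ (λ x → sym (∑-distrib-+ (λ y → below x y * H x y) _)) ⟩
  sum (λ x → sum (λ y → below x y * H x y + below y x * H x y))       ≡⟨ sum-cong-≗ (λ x → sum-cong-≗ λ y → split x y) ⟩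
  sum (λ x → sum (λ y → offDiag x y * H x y))                         ∎
  where
  open ≡-Reasoning
  S = sum (λ x → sum (λ y → below x y * H x y))
  split : ∀ x y → below x y * H x y + below y x * H x y ≡ offDiag x y * H x y
  split x y = trans (sym (ℕP.*-distribʳ-+ (H x y) (below x y) (below y x))) (cong (_* H x y) (below-split x y))

symmetric-sum : ∀ {n} (f : Fin n → Fin n → ℕ) (g : Fin n → ℕ) → (∀ x y → f x y ≡ f y x) →
  sum (λ x → sum (λ y → f x y * (g x + g y))) ≡ 2 * sum (λ x → sum (f x) * g x)
symmetric-sum {n} f g f-sym = begin
  sum (λ x → sum (λ y → f x y * (g x + g y)))
    ≡⟨ sum-cong-≗ (λ x → trans (sum-cong-≗ λ y → ℕP.*-distribˡ-+ (f x y) (g x) (g y)) (∑-distrib-+ (λ y → f x y * g x) (λ y → f x y * g y))) ⟩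
  sum (λ x → sum (λ y → f x y * g x) + sum (λ y → f x y * g y))
    ≡⟨ ∑-distrib-+ (λ x → sum (λ y → f x y * g x)) (λ x → sum (λ y → f x y * g y)) ⟩
  L + sum (λ x → sum (λ y → f x y * g y))
    ≡⟨ cong (λ r → L + r) (trans (∑-comm (λ x y → f x y * g y)) (sum-cong-≗ λ y → sum-cong-≗ λ x → cong (_* g y) (f-sym x y))) ⟩
  L + L
    ≡⟨ cong (λ r → L + r) (sym (ℕP.+-identityʳ L)) ⟩
  2 * L
    ≡⟨ cong (2 *_) (sum-cong-≗ λ x → sym (*-distribʳ-sum (g x) (f x))) ⟩
  2 * sum (λ x → sum (f x) * g x) ∎
  where
  open ≡-Reasoning
  L = sum (λ x → sum (λ y → f x y * g x))

W-closed : ∀ {n} (A : Fin n → Fin n → Bool) → (∀ x y → A x y ≡ A y x) → (∀ x → A x x ≡ false) →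
  W A ≡ sum (λ x → deg A x * (n ∸ 1) + deg A x * deg A x)
W-closed {n} A A-sym A-irrefl = ℕP.*-cancelˡ-≡ (W A) _ 2 (begin
  2 * W A
    ≡⟨ cong (2 *_) (sum-cong-≗ λ x → sum-cong-≗ λ y → weight-below x y) ⟩
  2 * sum (λ x → sum (λ y → below x y * H x y))
    ≡⟨ ordered-pairs H (λ x y → cong₂ _*_ (ℕP.+-comm (d x) (d y)) (cong (λ b → 1 + 𝟙 b) (A-sym x y))) ⟩
  sum (λ x → sum (λ y → offDiag x y * H x y))
    ≡⟨ sum-cong-≗ (λ x → trans (sum-cong-≗ λ y → expand x y) (∑-distrib-+ (λ y → offDiag x y * (d x + d y)) (λ y → a x y * (d x + d y)))) ⟩
  sum (λ x → sum (λ y → offDiag x y * (d x + d y)) + sum (λ y → a x y * (d x + d y)))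
    ≡⟨ ∑-distrib-+ (λ x → sum (λ y → offDiag x y * (d x + d y))) (λ x → sum (λ y → a x y * (d x + d y))) ⟩
  sum (λ x → sum (λ y → offDiag x y * (d x + d y))) + sum (λ x → sum (λ y → a x y * (d x + d y)))
    ≡⟨ cong₂ _+_ (symmetric-sum offDiag d offDiag-sym) (symmetric-sum a d (λ x y → cong 𝟙 (A-sym x y))) ⟩
  2 * sum (λ x → sum (offDiag x) * d x) + 2 * sum (λ x → sum (a x) * d x)
    ≡⟨ sym (ℕP.*-distribˡ-+ 2 (sum (λ x → sum (offDiag x) * d x)) (sum (λ x → sum (a x) * d x))) ⟩
  2 * (sum (λ x → sum (offDiag x) * d x) + sum (λ x → d x * d x))
    ≡⟨ cong (2 *_) (trans (cong (_+ sum (λ x → d x * d x)) (sum-cong-≗ λ x → trans (cong (_* d x) (offDiag-row x)) (ℕP.*-comm (n ∸ 1) (d x))))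
                          (sym (∑-distrib-+ (λ x → d x * (n ∸ 1)) (λ x → d x * d x)))) ⟩
  2 * sum (λ x → d x * (n ∸ 1) + d x * d x) ∎)
  where
  open ≡-Reasoning
  d = deg A
  a : Fin n → Fin n → ℕ
  a x y = 𝟙 (A x y)
  H : Fin n → Fin n → ℕ
  H x y = (d x + d y) * (1 + a x y)
  weight-below : ∀ x y → pairWeight A x y ≡ below x y * H x y
  weight-below x y with toℕ x <ᵇ toℕ y
  ... | true = sym (ℕP.+-identityʳ (H x y))
  ... | false = refl
  -- off the diagonal H = (d x + d y) + a·(d x + d y); on it both sides vanish
  expand : ∀ x y → offDiag x y * H x y ≡ offDiag x y * (d x + d y) + a x y * (d x + d y)
  expand x y with x ≟ y
  ... | yes refl rewrite A-irrefl x = refl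
  ... | no _ = distribute (d x + d y) (a x y)
    where
    distribute : ∀ s b → 1 * (s * (1 + b)) ≡ 1 * s + b * s
    distribute = ℕRing.solve-∀

sum-mono : ∀ {n} {f g : Fin n → ℕ} → (∀ i → f i ≤ g i) → sum f ≤ sum g
sum-mono {zero} f≤g = z≤n
sum-mono {suc n} f≤g = ℕP.+-mono-≤ (f≤g fzero) (sum-mono (f≤g ∘ fsuc))

sum-mono-< : ∀ {n} {f g : Fin n → ℕ} → (∀ i → f i ≤ g i) → ∀ i → f i < g i → sum f < sum g
sum-mono-< {suc n} f≤g fzero lt = ℕP.+-mono-<-≤ lt (sum-mono (f≤g ∘ fsuc))
sum-mono-< {suc n} f≤g (fsuc i) lt = ℕP.+-mono-≤-< (f≤g fzero) (sum-mono-< (f≤g ∘ fsuc) i lt)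

_⊆_ : ∀ {n} → (Fin n → Fin n → Bool) → (Fin n → Fin n → Bool) → Set
A ⊆ B = ∀ x y → A x y ≡ true → B x y ≡ true

module Monotone {n} {A B : Fin n → Fin n → Bool} (A⊆B : A ⊆ B) where

  𝟙-mono : ∀ x y → 𝟙 (A x y) ≤ 𝟙 (B x y)
  𝟙-mono x y with A x y in xy
  ... | false = z≤n
  ... | true rewrite A⊆B x y xy = ℕP.≤-refl

  deg-mono : ∀ x → deg A x ≤ deg B x
  deg-mono x = sum-mono (𝟙-mono x)

  pairWeight-mono : ∀ x y → pairWeight A x y ≤ pairWeight B x y
  pairWeight-mono x y with toℕ x <ᵇ toℕ y
  ... | false = z≤n
  ... | true = ℕP.*-mono-≤ (ℕP.+-mono-≤ (deg-mono x) (deg-mono y)) (s≤s (𝟙-mono x y))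

  W-mono : W A ≤ W B
  W-mono = sum-mono (λ x → sum-mono (pairWeight-mono x))

  W-mono-< : ∀ x y → (toℕ x <ᵇ toℕ y) ≡ true → deg A x < deg B x → W A < W B
  W-mono-< x y x<y dx< = sum-mono-< (λ u → sum-mono (pairWeight-mono u)) x
    (sum-mono-< (pairWeight-mono x) y weight<)
    where
    weight< : pairWeight A x y < pairWeight B x y
    weight< rewrite x<y = ℕP.≤-trans (ℕP.*-monoˡ-< (1 + 𝟙 (A x y)) (ℕP.+-mono-<-≤ dx< (deg-mono y)))
                                     (ℕP.*-monoʳ-≤ (deg B x + deg B y) (s≤s (𝟙-mono x y)))

  missing : ∀ u v → A u v ≡ false → B u v ≡ true → deg A u < deg B u
  missing u v auv buv = sum-mono-< (𝟙-mono u) v (subst₂ (λ p q → 𝟙 p < 𝟙 q) (sym auv) (sym buv) (s≤s z≤n))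

  W-rigid : (∀ x y → A x y ≡ A y x) → (∀ x y → B x y ≡ B y x) → (∀ x → B x x ≡ false) →
    W A ≡ W B → ∀ x y → A x y ≡ B x y
  W-rigid A-sym B-sym B-irrefl W≡ x y with A x y in xy | B x y in bxy
  ... | true | true = refl
  ... | false | false = refl
  ... | true | false with () ← trans (sym (A⊆B x y xy)) bxy
  ... | false | true with ordered x≢y
    where
    x≢y : x ≢ y
    x≢y refl with () ← trans (sym bxy) (B-irrefl x)
  ...   | inj₁ x<y = ⊥-elim (ℕP.<-irrefl W≡ (W-mono-< x y x<y (missing x y xy bxy)))
  ...   | inj₂ y<x = ⊥-elim (ℕP.<-irrefl W≡ (W-mono-< y x y<x
            (missing y x (trans (A-sym y x) xy) (trans (B-sym y x) bxy))))

data Class : Set where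
  clique left right : Class

-- The numbering of the classes used by `cls` and `crossAdj` in Defs.
code : Class → ℕ
code clique = 0
code left = 1
code right = 2

classAdj : ∀ {n} → (Fin n → Class) → Fin n → Fin n → Bool
classAdj cl x y = not ⌊ x ≟ y ⌋ ∧ crossAdj (code (cl x)) (code (cl y))

crossAdj-sym : ∀ c d → crossAdj (code c) (code d) ≡ crossAdj (code d) (code c)
crossAdj-sym clique clique = refl
crossAdj-sym clique left = refl
crossAdj-sym clique right = refl
crossAdj-sym left clique = refl
crossAdj-sym left left = refl
crossAdj-sym left right = refl
crossAdj-sym right clique = refl
crossAdj-sym right left = refl
crossAdj-sym right right = refl

classAdj-sym : ∀ {n} (cl : Fin n → Class) x y → classAdj cl x y ≡ classAdj cl y x
classAdj-sym cl x y = cong₂ _∧_ (distinct-sym x y) (crossAdj-sym (cl x) (cl y))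

classAdj-irrefl : ∀ {n} (cl : Fin n → Class) x → classAdj cl x x ≡ false
classAdj-irrefl cl x with x ≟ x
... | yes _ = refl
... | no x≢x = ⊥-elim (x≢x refl)

is : Class → Class → ℕ
is clique clique = 1
is left left = 1
is right right = 1
is _ _ = 0

count : ∀ {n} → (Fin n → Class) → Class → ℕ
count cl c = sum (λ x → is c (cl x))

sum-by-class : ∀ {n} (cl : Fin n → Class) (g : Class → ℕ) →
  sum (λ x → g (cl x)) ≡ count cl clique * g clique + count cl left * g left + count cl right * g right
sum-by-class {n} cl g = begin
  sum (λ x → g (cl x))
    ≡⟨ sum-cong-≗ (λ x → split (cl x)) ⟩
  sum (λ x → is clique (cl x) * g clique + is left (cl x) * g left + is right (cl x) * g right)
    ≡⟨ trans (∑-distrib-+ (λ x → is clique (cl x) * g clique + is left (cl x) * g left) (λ x → is right (cl x) * g right))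
             (cong (_+ sum (λ x → is right (cl x) * g right)) (∑-distrib-+ (λ x → is clique (cl x) * g clique) (λ x → is left (cl x) * g left))) ⟩
  sum (λ x → is clique (cl x) * g clique) + sum (λ x → is left (cl x) * g left) + sum (λ x → is right (cl x) * g right)
    ≡⟨ sym (cong₂ _+_ (cong₂ _+_ (*-distribʳ-sum (g clique) (λ x → is clique (cl x))) (*-distribʳ-sum (g left) (λ x → is left (cl x))))
                      (*-distribʳ-sum (g right) (λ x → is right (cl x)))) ⟩
  count cl clique * g clique + count cl left * g left + count cl right * g right ∎
  where
  open ≡-Reasoning
  split : ∀ c → g c ≡ is clique c * g clique + is left c * g left + is right c * g right
  split clique = first (g clique) (g left) (g right)
    where first : ∀ x y z → x ≡ 1 * x + 0 * y + 0 * z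
          first = ℕRing.solve-∀
  split left = second (g clique) (g left) (g right)
    where second : ∀ x y z → y ≡ 0 * x + 1 * y + 0 * z
          second = ℕRing.solve-∀
  split right = third (g clique) (g left) (g right)
    where third : ∀ x y z → z ≡ 0 * x + 0 * y + 1 * z
          third = ℕRing.solve-∀

class-sizes : ∀ {n} (cl : Fin n → Class) → count cl clique + count cl left + count cl right ≡ n
class-sizes {n} cl = trans (sym (trans (sum-by-class cl (λ _ → 1)) (ones-times (count cl clique) (count cl left) (count cl right)))) (sum-ones n)
  where
  ones-times : ∀ p q r → p * 1 + q * 1 + r * 1 ≡ p + q + r
  ones-times = ℕRing.solve-∀

classDeg : ∀ {n} → (Fin n → Class) → Class → ℕ
classDeg {n} cl clique = n ∸ 1
classDeg cl left = count cl clique + count cl right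
classDeg cl right = count cl clique + count cl left

𝟙-∧ : ∀ p q → 𝟙 (p ∧ q) ≡ 𝟙 p * 𝟙 q
𝟙-∧ true q = sym (ℕP.+-identityʳ (𝟙 q))
𝟙-∧ false q = refl

deg-classAdj : ∀ {n} (cl : Fin n → Class) x → deg (classAdj cl) x ≡ classDeg cl (cl x)
deg-classAdj {n} cl x = trans (sum-cong-≗ λ y → 𝟙-∧ (not ⌊ x ≟ y ⌋) _) (by-class (cl x) refl)
  where
  cross : Class → Class → ℕ
  cross c d = 𝟙 (crossAdj (code c) (code d))
  -- outside the clique, x is never adjacent to its own class, so [x ≠ y] is redundant
  independent-row : ∀ c → cl x ≡ c → crossAdj (code c) (code c) ≡ false → ∀ y →
    offDiag x y * cross c (cl y) ≡ cross c (cl y)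
  independent-row c clx c-indep y with x ≟ y
  ... | no _ = ℕP.*-identityˡ (cross c (cl y))
  ... | yes refl rewrite clx | c-indep = refl
  outside-left : ∀ p q r → p * 1 + q * 0 + r * 1 ≡ p + r
  outside-left = ℕRing.solve-∀
  outside-right : ∀ p q r → p * 1 + q * 1 + r * 0 ≡ p + q
  outside-right = ℕRing.solve-∀
  by-class : ∀ c → cl x ≡ c → sum (λ y → offDiag x y * cross c (cl y)) ≡ classDeg cl c
  by-class clique _ = trans (sum-cong-≗ λ y → trans (cong (offDiag x y *_) (clique-row (cl y))) (ℕP.*-identityʳ _)) (offDiag-row x)
    where
    clique-row : ∀ d → cross clique d ≡ 1
    clique-row clique = refl
    clique-row left = refl
    clique-row right = refl
  by-class left clx = trans (sum-cong-≗ (independent-row left clx refl))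
    (trans (sum-by-class cl (cross left))
           (outside-left (count cl clique) (count cl left) (count cl right)))
  by-class right clx = trans (sum-cong-≗ (independent-row right clx refl))
    (trans (sum-by-class cl (cross right))
           (outside-right (count cl clique) (count cl left) (count cl right)))

-- W of K_s ∨ (K̄_a ∨ K̄_b) on k + 1 vertices: by the closed form of W, each
-- vertex contributes d(d + k), with d = k, s + b, s + a in the three classes.
threeClassW : ℕ → ℕ → ℕ → ℕ → ℕ
threeClassW k s a b = s * (k * k + k * k) + a * ((s + b) * k + (s + b) * (s + b)) + b * ((s + a) * k + (s + a) * (s + a))

W-classAdj : ∀ {n} (cl : Fin n → Class) →
  W (classAdj cl) ≡ threeClassW (n ∸ 1) (count cl clique) (count cl left) (count cl right)
W-classAdj {n} cl = begin
  W (classAdj cl)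
    ≡⟨ W-closed (classAdj cl) (classAdj-sym cl) (classAdj-irrefl cl) ⟩
  sum (λ x → deg (classAdj cl) x * (n ∸ 1) + deg (classAdj cl) x * deg (classAdj cl) x)
    ≡⟨ sum-cong-≗ (λ x → cong (λ d → d * (n ∸ 1) + d * d) (deg-classAdj cl x)) ⟩
  sum (λ x → contribution (cl x))
    ≡⟨ sum-by-class cl contribution ⟩
  threeClassW (n ∸ 1) (count cl clique) (count cl left) (count cl right) ∎
  where
  open ≡-Reasoning
  contribution : Class → ℕ
  contribution c = classDeg cl c * (n ∸ 1) + classDeg cl c * classDeg cl c

classesOf : ∀ {n} → Subset n → (Fin n → Bool) → Fin n → Class
classesOf S c x = if lookup S x then clique else (if c x then left else right)

count-classesOf : ∀ {n} (S : Subset n) c → count (classesOf S c) clique ≡ ∣ S ∣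
count-classesOf S c = trans (sum-cong-≗ in-clique) (sym (size S))
  where
  in-clique : ∀ x → is clique (classesOf S c x) ≡ 𝟙 (lookup S x)
  in-clique x with lookup S x | c x
  ... | true | _ = refl
  ... | false | true = refl
  ... | false | false = refl
  size : ∀ {k} (R : Subset k) → ∣ R ∣ ≡ sum (λ x → 𝟙 (lookup R x))
  size [] = refl
  size (true ∷ R) = cong suc (size R)
  size (false ∷ R) = size R

crossAdj-false : ∀ p q → crossAdj (code p) (code q) ≡ false → p ≡ q × p ≢ clique
crossAdj-false left left _ = refl , λ ()
crossAdj-false right right _ = refl , λ ()
crossAdj-false clique clique ()
crossAdj-false clique left ()
crossAdj-false clique right ()
crossAdj-false left clique ()
crossAdj-false left right ()
crossAdj-false right clique ()
crossAdj-false right left ()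

same-independent-class : ∀ {n} (S : Subset n) (c : Fin n → Bool) x y →
  classesOf S c x ≡ classesOf S c y → classesOf S c x ≢ clique → x ∉ S × y ∉ S × c x ≡ c y
same-independent-class S c x y same independent with lookup S x in Sx | lookup S y in Sy
... | true | _ = ⊥-elim (independent refl)
... | false | true = ⊥-elim (independent same)
... | false | false = outside Sx , outside Sy , same-colour (c x) (c y) same
  where
  outside : ∀ {z} → lookup S z ≡ false → z ∉ S
  outside Sz z∈S with () ← trans (sym Sz) ([]=⇒lookup z∈S)
  same-colour : ∀ p q → (if p then left else right) ≡ (if q then left else right) → p ≡ q
  same-colour true true _ = refl
  same-colour false false _ = refl

colouring⊆classAdj : ∀ {n} (G : Graph n) (S : Subset n) (c : Fin n → Bool) →
  (∀ x y → x ∉ S → y ∉ S → T (adj G x y) → c x ≢ c y) → adj G ⊆ classAdj (classesOf S c)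
colouring⊆classAdj G S c proper x y xy with x ≟ y
... | yes refl with () ← trans (sym xy) (irrefl G x)
... | no _ with crossAdj (code (classesOf S c x)) (code (classesOf S c y)) in cross
...   | true = refl
...   | false with crossAdj-false _ _ cross
...     | same , independent with same-independent-class S c x y same independent
...       | x∉S , y∉S , cx≡cy = ⊥-elim (proper x y x∉S y∉S (subst T (sym xy) tt) cx≡cy)

swap : Class → Class
swap clique = clique
swap left = right
swap right = left

classAdj-swap : ∀ {n} (cl : Fin n → Class) → ∀ x y → classAdj (swap ∘ cl) x y ≡ classAdj cl x y
classAdj-swap cl x y = cong (not ⌊ x ≟ y ⌋ ∧_) (cross-swap (cl x) (cl y))
  where
  cross-swap : ∀ p q → crossAdj (code (swap p)) (code (swap q)) ≡ crossAdj (code p) (code q)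
  cross-swap clique clique = refl
  cross-swap clique left = refl
  cross-swap clique right = refl
  cross-swap left clique = refl
  cross-swap left left = refl
  cross-swap left right = refl
  cross-swap right clique = refl
  cross-swap right left = refl
  cross-swap right right = refl

count-swap : ∀ {n} (cl : Fin n → Class) c → count (swap ∘ cl) c ≡ count cl (swap c)
count-swap cl c = sum-cong-≗ (λ x → is-swap c (cl x))
  where
  is-swap : ∀ c d → is c (swap d) ≡ is (swap c) d
  is-swap clique clique = refl
  is-swap clique left = refl
  is-swap clique right = refl
  is-swap left clique = refl
  is-swap left left = refl
  is-swap left right = refl
  is-swap right clique = refl
  is-swap right left = refl
  is-swap right right = refl

-- A three-class graph containing G with at most m clique vertices and the
-- larger independent class on the left: what v₂(G) ≤ m provides.
record ClassCover {n} (G : Graph n) (m : ℕ) : Set where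
  field
    classOf : Fin n → Class
    covers : adj G ⊆ classAdj classOf
    clique≤m : count classOf clique ≤ m
    right≤left : count classOf right ≤ count classOf left

classCover : ∀ {n} (G : Graph n) m → v₂≤ G m → ClassCover G m
classCover G m (S , ∣S∣≤m , c , proper) with ℕP.≤-total (count cl right) (count cl left)
  where cl = classesOf S c
... | inj₁ right≤left = record
  { classOf = classesOf S c
  ; covers = colouring⊆classAdj G S c proper
  ; clique≤m = subst (_≤ m) (sym (count-classesOf S c)) ∣S∣≤m
  ; right≤left = right≤left }
... | inj₂ left≤right = record
  { classOf = swap ∘ classesOf S c
  ; covers = λ x y xy → trans (classAdj-swap (classesOf S c) x y) (colouring⊆classAdj G S c proper x y xy)
  ; clique≤m = subst (_≤ m) (sym (trans (count-swap (classesOf S c) clique) (count-classesOf S c))) ∣S∣≤m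
  ; right≤left = subst₂ _≤_ (sym (count-swap (classesOf S c) right)) (sym (count-swap (classesOf S c) left)) left≤right }

evenNumerator : ℤ → ℤ → ℤ
evenNumerator n m =
  + 3 ℤ.* n ℤ.* n ℤ.* n ℤ.- m ℤ.* m ℤ.* m ℤ.- + 3 ℤ.* m ℤ.* m ℤ.* n
  ℤ.+ + 9 ℤ.* m ℤ.* n ℤ.* n ℤ.- + 2 ℤ.* n ℤ.* n ℤ.+ + 2 ℤ.* m ℤ.* m
  ℤ.- + 16 ℤ.* m ℤ.* n ℤ.+ + 8 ℤ.* m

oddNumerator : ℤ → ℤ → ℤ
oddNumerator n m =
  + 3 ℤ.* n ℤ.* n ℤ.* n ℤ.- m ℤ.* m ℤ.* m ℤ.- + 3 ℤ.* m ℤ.* m ℤ.* n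
  ℤ.+ + 9 ℤ.* m ℤ.* n ℤ.* n ℤ.- + 2 ℤ.* n ℤ.* n ℤ.+ + 2 ℤ.* m ℤ.* m
  ℤ.- + 16 ℤ.* m ℤ.* n ℤ.- + 3 ℤ.* n ℤ.+ + 5 ℤ.* m ℤ.+ + 2

-- Write n = s + a + b, m = s + t, a = b + d and a + b = t + 2 + u.  The
-- bound exceeds 4·threeClassW by the gap c·d² + t·Q below: the imbalance
-- d of the independent classes costs c = 6s + 3(a + b) - 2 per unit of d²,
-- and each of the t missing clique vertices costs Q.
imbalanceCost : ℕ → ℕ → ℕ → ℕ
imbalanceCost s t u = 4 + (6 * s + 3 * t + 3 * u)

cliqueCost : ℕ → ℕ → ℕ → ℕ
cliqueCost s t u = 12 + (16 * t + 5 * t * t + 20 * u + 15 * t * u + 9 * u * u + 12 * s + 6 * s * t + 12 * s * u)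

gap : ℕ → ℕ → ℕ → ℕ → ℕ
gap s t u d = imbalanceCost s t u * (d * d) + t * cliqueCost s t u

-- The polynomial identities behind the bounds, over ℤ (written out, as the
-- reflective ring solver requires).
even-gap-identity : ∀ S A B T →
  let N = S ℤ.+ A ℤ.+ B ; M = S ℤ.+ T ; K = N ℤ.- + 1 ; U = A ℤ.+ B ℤ.- (T ℤ.+ + 2) ; D = A ℤ.- B in
  + 3 ℤ.* N ℤ.* N ℤ.* N ℤ.- M ℤ.* M ℤ.* M ℤ.- + 3 ℤ.* M ℤ.* M ℤ.* N
  ℤ.+ + 9 ℤ.* M ℤ.* N ℤ.* N ℤ.- + 2 ℤ.* N ℤ.* N ℤ.+ + 2 ℤ.* M ℤ.* M
  ℤ.- + 16 ℤ.* M ℤ.* N ℤ.+ + 8 ℤ.* M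
  ≡ + 4 ℤ.* (S ℤ.* (K ℤ.* K ℤ.+ K ℤ.* K) ℤ.+ A ℤ.* ((S ℤ.+ B) ℤ.* K ℤ.+ (S ℤ.+ B) ℤ.* (S ℤ.+ B))
             ℤ.+ B ℤ.* ((S ℤ.+ A) ℤ.* K ℤ.+ (S ℤ.+ A) ℤ.* (S ℤ.+ A)))
    ℤ.+ ((+ 4 ℤ.+ (+ 6 ℤ.* S ℤ.+ + 3 ℤ.* T ℤ.+ + 3 ℤ.* U)) ℤ.* (D ℤ.* D)
         ℤ.+ T ℤ.* (+ 12 ℤ.+ (+ 16 ℤ.* T ℤ.+ + 5 ℤ.* T ℤ.* T ℤ.+ + 20 ℤ.* U ℤ.+ + 15 ℤ.* T ℤ.* U ℤ.+ + 9 ℤ.* U ℤ.* U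
                               ℤ.+ + 12 ℤ.* S ℤ.+ + 6 ℤ.* S ℤ.* T ℤ.+ + 12 ℤ.* S ℤ.* U)))
even-gap-identity = ℤRing.solve-∀

odd-vs-even : ∀ N M →
  + 3 ℤ.* N ℤ.* N ℤ.* N ℤ.- M ℤ.* M ℤ.* M ℤ.- + 3 ℤ.* M ℤ.* M ℤ.* N
  ℤ.+ + 9 ℤ.* M ℤ.* N ℤ.* N ℤ.- + 2 ℤ.* N ℤ.* N ℤ.+ + 2 ℤ.* M ℤ.* M
  ℤ.- + 16 ℤ.* M ℤ.* N ℤ.- + 3 ℤ.* N ℤ.+ + 5 ℤ.* M ℤ.+ + 2
  ℤ.+ (+ 3 ℤ.* N ℤ.+ + 3 ℤ.* M ℤ.- + 2)
  ≡ + 3 ℤ.* N ℤ.* N ℤ.* N ℤ.- M ℤ.* M ℤ.* M ℤ.- + 3 ℤ.* M ℤ.* M ℤ.* N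
    ℤ.+ + 9 ℤ.* M ℤ.* N ℤ.* N ℤ.- + 2 ℤ.* N ℤ.* N ℤ.+ + 2 ℤ.* M ℤ.* M
    ℤ.- + 16 ℤ.* M ℤ.* N ℤ.+ + 8 ℤ.* M
odd-vs-even = ℤRing.solve-∀

odd-lowering : ∀ S A B T → let U = A ℤ.+ B ℤ.- (T ℤ.+ + 2) in
  + 3 ℤ.* (S ℤ.+ A ℤ.+ B) ℤ.+ + 3 ℤ.* (S ℤ.+ T) ℤ.- + 2 ≡ (+ 4 ℤ.+ (+ 6 ℤ.* S ℤ.+ + 3 ℤ.* T ℤ.+ + 3 ℤ.* U)) ℤ.+ + 3 ℤ.* T
odd-lowering = ℤRing.solve-∀

-- This transports the
-- integer identities above back to the natural numbers counted in graphs.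
infixl 6 _⊕_
infixl 7 _⊗_

data Poly (k : ℕ) : Set where
  var : Fin k → Poly k
  lit : ℕ → Poly k
  _⊕_ _⊗_ : Poly k → Poly k → Poly k

⟦_⟧ℕ : ∀ {k} → Poly k → (Fin k → ℕ) → ℕ
⟦ var i ⟧ℕ ρ = ρ i
⟦ lit c ⟧ℕ ρ = c
⟦ p ⊕ q ⟧ℕ ρ = ⟦ p ⟧ℕ ρ + ⟦ q ⟧ℕ ρ
⟦ p ⊗ q ⟧ℕ ρ = ⟦ p ⟧ℕ ρ * ⟦ q ⟧ℕ ρ

⟦_⟧ℤ : ∀ {k} → Poly k → (Fin k → ℤ) → ℤ
⟦ var i ⟧ℤ ρ = ρ i
⟦ lit c ⟧ℤ ρ = + c
⟦ p ⊕ q ⟧ℤ ρ = ⟦ p ⟧ℤ ρ ℤ.+ ⟦ q ⟧ℤ ρ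
⟦ p ⊗ q ⟧ℤ ρ = ⟦ p ⟧ℤ ρ ℤ.* ⟦ q ⟧ℤ ρ

⟦⟧-cast : ∀ {k} (p : Poly k) ρ → + ⟦ p ⟧ℕ ρ ≡ ⟦ p ⟧ℤ (+_ ∘ ρ)
⟦⟧-cast (var i) ρ = refl
⟦⟧-cast (lit c) ρ = refl
⟦⟧-cast (p ⊕ q) ρ = trans (ℤP.pos-+ (⟦ p ⟧ℕ ρ) (⟦ q ⟧ℕ ρ)) (cong₂ ℤ._+_ (⟦⟧-cast p ρ) (⟦⟧-cast q ρ))
⟦⟧-cast (p ⊗ q) ρ = trans (ℤP.pos-* (⟦ p ⟧ℕ ρ) (⟦ q ⟧ℕ ρ)) (cong₂ ℤ._*_ (⟦⟧-cast p ρ) (⟦⟧-cast q ρ))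

boundᴾ : Poly 7
boundᴾ = lit 4 ⊗ (s ⊗ (k ⊗ k ⊕ k ⊗ k) ⊕ a ⊗ ((s ⊕ b) ⊗ k ⊕ (s ⊕ b) ⊗ (s ⊕ b)) ⊕ b ⊗ ((s ⊕ a) ⊗ k ⊕ (s ⊕ a) ⊗ (s ⊕ a)))
  ⊕ ((lit 4 ⊕ (lit 6 ⊗ s ⊕ lit 3 ⊗ t ⊕ lit 3 ⊗ u)) ⊗ (d ⊗ d)
     ⊕ t ⊗ (lit 12 ⊕ (lit 16 ⊗ t ⊕ lit 5 ⊗ t ⊗ t ⊕ lit 20 ⊗ u ⊕ lit 15 ⊗ t ⊗ u ⊕ lit 9 ⊗ u ⊗ u
                        ⊕ lit 12 ⊗ s ⊕ lit 6 ⊗ s ⊗ t ⊕ lit 12 ⊗ s ⊗ u)))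
  where
  k s a b t u d : Poly 7
  k = var (# 0)
  s = var (# 1)
  a = var (# 2)
  b = var (# 3)
  t = var (# 4)
  u = var (# 5)
  d = var (# 6)

record Offsets (m s a b : ℕ) : Set where
  field
    t u d : ℕ
    m≡s+t : m ≡ s + t
    a≡b+d : a ≡ b + d
    a+b≡t+2+u : a + b ≡ t + 2 + u

offsets : ∀ {m s a b} → s ≤ m → b ≤ a → m + 2 ≤ s + a + b → Offsets m s a b
offsets {m} {s} {a} {b} s≤m b≤a room = record
  { t = m ∸ s ; u = a + b ∸ (m ∸ s + 2) ; d = a ∸ b
  ; m≡s+t = sym (ℕP.m+[n∸m]≡n s≤m)
  ; a≡b+d = sym (ℕP.m+[n∸m]≡n b≤a)
  ; a+b≡t+2+u = sym (ℕP.m+[n∸m]≡n t+2≤a+b) }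
  where
  t+2≤a+b : m ∸ s + 2 ≤ a + b
  t+2≤a+b = ℕP.+-cancelˡ-≤ s (m ∸ s + 2) (a + b)
    (subst₂ _≤_ (trans (cong (_+ 2) (sym (ℕP.m+[n∸m]≡n s≤m))) (ℕP.+-assoc s (m ∸ s) 2)) (ℕP.+-assoc s a b) room)

pos-offset : ∀ {x y z} → x ≡ y + z → + z ≡ + x ℤ.- + y
pos-offset {x} {y} {z} refl = trans (cancel (+ y) (+ z)) (cong (ℤ._- + y) (sym (ℤP.pos-+ y z)))
  where
  cancel : ∀ Y Z → Z ≡ Y ℤ.+ Z ℤ.- Y
  cancel = ℤRing.solve-∀

module Numerators {n m s a b : ℕ} (n≡ : s + a + b ≡ n) (o : Offsets m s a b) where
  open Offsets o

  private
    S A B T′ : ℤ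
    S = + s
    A = + a
    B = + b
    T′ = + t

    N≡ : + n ≡ S ℤ.+ A ℤ.+ B
    N≡ = trans (cong +_ (sym n≡)) (trans (ℤP.pos-+ (s + a) b) (cong (ℤ._+ B) (ℤP.pos-+ s a)))

    M≡ : + m ≡ S ℤ.+ T′
    M≡ = trans (cong +_ m≡s+t) (ℤP.pos-+ s t)

    K≡ : + (n ∸ 1) ≡ S ℤ.+ A ℤ.+ B ℤ.- + 1
    K≡ = trans (pos-offset (sym (ℕP.m+[n∸m]≡n 1≤n))) (cong (ℤ._- + 1) N≡)
      where
      1≤n : 1 ≤ n
      1≤n = subst (1 ≤_) n≡ (ℕP.≤-trans 1≤a+b (ℕP.≤-trans (ℕP.m≤n+m (a + b) s) (ℕP.≤-reflexive (sym (ℕP.+-assoc s a b)))))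
        where
        1≤a+b : 1 ≤ a + b
        1≤a+b = subst (1 ≤_) (sym a+b≡t+2+u) (ℕP.≤-trans (ℕP.≤-trans (s≤s z≤n) (ℕP.m≤n+m 2 t)) (ℕP.m≤m+n (t + 2) u))

    U≡ : + u ≡ A ℤ.+ B ℤ.- (T′ ℤ.+ + 2)
    U≡ = trans (pos-offset a+b≡t+2+u) (cong₂ ℤ._-_ (ℤP.pos-+ a b) (ℤP.pos-+ t 2))

    D≡ : + d ≡ A ℤ.- B
    D≡ = pos-offset a≡b+d

    boundAt : ℤ → ℤ → ℤ → ℤ
    boundAt K U D = ⟦ boundᴾ ⟧ℤ (lookup (K ∷ S ∷ A ∷ B ∷ T′ ∷ U ∷ D ∷ []))

  even-numerator : evenNumerator (+ n) (+ m) ≡ + (4 * threeClassW (n ∸ 1) s a b + gap s t u d)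
  even-numerator = begin
    evenNumerator (+ n) (+ m)                                        ≡⟨ cong₂ evenNumerator N≡ M≡ ⟩
    evenNumerator (S ℤ.+ A ℤ.+ B) (S ℤ.+ T′)                          ≡⟨ even-gap-identity S A B T′ ⟩
    boundAt (S ℤ.+ A ℤ.+ B ℤ.- + 1) (A ℤ.+ B ℤ.- (T′ ℤ.+ + 2)) (A ℤ.- B) ≡⟨ sym (cong₂ (λ K (UD : ℤ × ℤ) → boundAt K (proj₁ UD) (proj₂ UD)) K≡ (cong₂ _,_ U≡ D≡)) ⟩
    boundAt (+ (n ∸ 1)) (+ u) (+ d)                                  ≡⟨ sym (⟦⟧-cast boundᴾ (lookup (n ∸ 1 ∷ s ∷ a ∷ b ∷ t ∷ u ∷ d ∷ []))) ⟩
    + (4 * threeClassW (n ∸ 1) s a b + gap s t u d)                  ∎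
    where open ≡-Reasoning

  odd-numerator : oddNumerator (+ n) (+ m) ℤ.+ + (imbalanceCost s t u + 3 * t) ≡ evenNumerator (+ n) (+ m)
  odd-numerator = trans (cong (λ x → oddNumerator (+ n) (+ m) ℤ.+ x) lowering) (odd-vs-even (+ n) (+ m))
    where
    open ≡-Reasoning
    loweringᴾ : Poly 3
    loweringᴾ = (lit 4 ⊕ (lit 6 ⊗ var (# 0) ⊕ lit 3 ⊗ var (# 1) ⊕ lit 3 ⊗ var (# 2))) ⊕ lit 3 ⊗ var (# 1)
    lowering : + (imbalanceCost s t u + 3 * t) ≡ + 3 ℤ.* + n ℤ.+ + 3 ℤ.* + m ℤ.- + 2
    lowering = begin
      + (imbalanceCost s t u + 3 * t)
        ≡⟨ ⟦⟧-cast loweringᴾ (lookup (s ∷ t ∷ u ∷ [])) ⟩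
      (+ 4 ℤ.+ (+ 6 ℤ.* S ℤ.+ + 3 ℤ.* T′ ℤ.+ + 3 ℤ.* + u)) ℤ.+ + 3 ℤ.* T′
        ≡⟨ cong (λ U → (+ 4 ℤ.+ (+ 6 ℤ.* S ℤ.+ + 3 ℤ.* T′ ℤ.+ + 3 ℤ.* U)) ℤ.+ + 3 ℤ.* T′) U≡ ⟩
      (+ 4 ℤ.+ (+ 6 ℤ.* S ℤ.+ + 3 ℤ.* T′ ℤ.+ + 3 ℤ.* (A ℤ.+ B ℤ.- (T′ ℤ.+ + 2)))) ℤ.+ + 3 ℤ.* T′
        ≡⟨ sym (odd-lowering S A B T′) ⟩
      + 3 ℤ.* (S ℤ.+ A ℤ.+ B) ℤ.+ + 3 ℤ.* (S ℤ.+ T′) ℤ.- + 2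
        ≡⟨ sym (cong₂ (λ N M → + 3 ℤ.* N ℤ.+ + 3 ℤ.* M ℤ.- + 2) N≡ M≡) ⟩
      + 3 ℤ.* + n ℤ.+ + 3 ℤ.* + m ℤ.- + 2 ∎

pos-cancel : ∀ Z x y → Z ℤ.+ + y ≡ + (x + y) → Z ≡ + x
pos-cancel Z x y eq = trans (cancel Z (+ y)) (trans (cong (ℤ._- + y) eq) (sym (pos-offset (ℕP.+-comm x y))))
  where
  cancel : ∀ P Q → P ≡ P ℤ.+ Q ℤ.- Q
  cancel = ℤRing.solve-∀

gap≡0 : ∀ s t u d → gap s t u d ≡ 0 → t ≡ 0 × d ≡ 0
gap≡0 s t u d g = t≡0 , d≡0
  where
  d≡0 : d ≡ 0
  d≡0 with ℕP.m*n≡0⇒m≡0∨n≡0 (imbalanceCost s t u) (ℕP.m+n≡0⇒m≡0 _ g)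
  ... | inj₂ dd≡0 with ℕP.m*n≡0⇒m≡0∨n≡0 d dd≡0
  ...   | inj₁ d≡0 = d≡0
  ...   | inj₂ d≡0 = d≡0
  t≡0 : t ≡ 0
  t≡0 with ℕP.m*n≡0⇒m≡0∨n≡0 t (ℕP.m+n≡0⇒n≡0 _ g)
  ... | inj₁ t≡0 = t≡0

gap-balanced : ∀ s u → gap s 0 u 0 ≡ 0
gap-balanced s u = trans (ℕP.+-identityʳ _) (ℕP.*-zeroʳ (imbalanceCost s 0 u))

fullCliqueOffsets : ∀ {s a b} d → a ≡ b + d → 2 ≤ a + b → Offsets s s a b
fullCliqueOffsets {s} {a} {b} d a≡b+d 2≤a+b = record
  { t = 0 ; u = a + b ∸ 2 ; d = d
  ; m≡s+t = sym (ℕP.+-identityʳ s)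
  ; a≡b+d = a≡b+d
  ; a+b≡t+2+u = sym (ℕP.m+[n∸m]≡n 2≤a+b) }

halve-even : ∀ x → x % 2 ≡ 0 → x ≡ x / 2 + x / 2
halve-even x x-even = trans (ℕDM.m≡m%n+[m/n]*n x 2) (trans (cong (_+ (x / 2) * 2) x-even) (double (x / 2)))
  where
  double : ∀ q → 0 + q * 2 ≡ q + q
  double = ℕRing.solve-∀

halve-odd : ∀ x → x % 2 ≡ 1 → x ≡ suc (x / 2) + x / 2
halve-odd x x-odd = trans (ℕDM.m≡m%n+[m/n]*n x 2) (trans (cong (_+ (x / 2) * 2) x-odd) (double (x / 2)))
  where
  double : ∀ q → 1 + q * 2 ≡ 1 + q + q
  double = ℕRing.solve-∀

half-double : ∀ q → (q + q) / 2 ≡ q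
half-double q = trans (cong (_/ 2) (twice q)) (ℕDM.m*n/n≡m q 2)
  where
  twice : ∀ q → q + q ≡ q * 2
  twice = ℕRing.solve-∀

half-double-suc : ∀ q → (suc q + q + 1) / 2 ≡ suc q
half-double-suc q = trans (cong (_/ 2) (twice q)) (ℕDM.m*n/n≡m (suc q) 2)
  where
  twice : ∀ q → 1 + q + q + 1 ≡ (1 + q) * 2
  twice = ℕRing.solve-∀

double-even : ∀ q → (q + q) % 2 ≡ 0
double-even q = trans (cong (_% 2) (twice q)) (ℕDM.m*n%n≡0 q 2)
  where
  twice : ∀ q → q + q ≡ q * 2
  twice = ℕRing.solve-∀

-- In the odd case the gap must pay for the lowering c + 3t, which it does
-- unless d = t = 0 (excluded by parity).  The excess X vanishes only for
-- t = 0 and d = 1.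
odd-excess : ∀ s t u d → (d ≡ 0 → t ≢ 0) →
  Σ ℕ λ X → gap s t u d ≡ (imbalanceCost s t u + 3 * t) + X × (X ≡ 0 → t ≡ 0 × d ≡ 1)
odd-excess s t u (suc e) _ =
  imbalanceCost s t u * (e * (2 + e)) + t * (cliqueCost s t u ∸ 3) ,
  unbalanced (imbalanceCost s t u) e t (cliqueCost s t u ∸ 3) , vanishing
  where
  unbalanced : ∀ c e t q → c * ((1 + e) * (1 + e)) + t * (3 + q) ≡ (c + 3 * t) + (c * (e * (2 + e)) + t * q)
  unbalanced = ℕRing.solve-∀
  vanishing : imbalanceCost s t u * (e * (2 + e)) + t * (cliqueCost s t u ∸ 3) ≡ 0 → t ≡ 0 × suc e ≡ 1
  vanishing X≡0 with ℕP.m*n≡0⇒m≡0∨n≡0 t (ℕP.m+n≡0⇒n≡0 _ X≡0)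
                   | ℕP.m*n≡0⇒m≡0∨n≡0 (imbalanceCost s t u) (ℕP.m+n≡0⇒m≡0 _ X≡0)
  ... | inj₁ t≡0 | inj₂ e[2+e]≡0 with ℕP.m*n≡0⇒m≡0∨n≡0 e e[2+e]≡0
  ...   | inj₁ refl = t≡0 , refl
odd-excess s (suc t) u zero _ =
  23 + (20 * t + 5 * t * t + 32 * u + 15 * t * u + 9 * u * u + 12 * s + 6 * s * t + 12 * s * u + t * cliqueCost s (suc t) u) ,
  balanced s t u , λ ()
  where
  balanced : ∀ s t u →
    (4 + (6 * s + 3 * (1 + t) + 3 * u)) * (0 * 0)
      + (1 + t) * (12 + (16 * (1 + t) + 5 * (1 + t) * (1 + t) + 20 * u + 15 * (1 + t) * u + 9 * u * u
                        + 12 * s + 6 * s * (1 + t) + 12 * s * u))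
    ≡ ((4 + (6 * s + 3 * (1 + t) + 3 * u)) + 3 * (1 + t))
      + (23 + (20 * t + 5 * t * t + 32 * u + 15 * t * u + 9 * u * u + 12 * s + 6 * s * t + 12 * s * u
               + t * (12 + (16 * (1 + t) + 5 * (1 + t) * (1 + t) + 20 * u + 15 * (1 + t) * u + 9 * u * u
                            + 12 * s + 6 * s * (1 + t) + 12 * s * u))))
  balanced = ℕRing.solve-∀
odd-excess s zero u zero parity = ⊥-elim (parity refl refl)

-- What the arithmetic supplies for Z/8 to be a sharp bound attained exactly
-- by K_m ∨ (K̄_a★ ∨ K̄_(n-m-a★)): over admissible class sizes (s ≤ m,
-- b ≤ a) Z exceeds 4·threeClassW, with no excess only at s = m and a = a★,
-- where equality does hold.
record SharpNumerator (n m a★ : ℕ) (Z : ℤ) : Set where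
  field
    excess : ∀ {s a b} → s + a + b ≡ n → s ≤ m → b ≤ a →
      Σ ℕ λ X → (Z ≡ + (4 * threeClassW (n ∸ 1) s a b + X)) × (X ≡ 0 → s ≡ m × a ≡ a★)
    fits : m + a★ ≤ n
    attained : Z ≡ + (4 * threeClassW (n ∸ 1) m a★ (n ∸ (m + a★)))

module ClassSizes {n m : ℕ} (room : m + 2 ≤ n) where

  n∸s : ∀ {s a b} → s + a + b ≡ n → n ∸ s ≡ a + b
  n∸s {s} {a} {b} n≡ = trans (cong (_∸ s) (trans (sym n≡) (ℕP.+-assoc s a b))) (ℕP.m+n∸m≡n s (a + b))

  2≤n∸m : 2 ≤ n ∸ m
  2≤n∸m = ℕP.m+n≤o⇒m≤o∸n 2 (subst (_≤ n) (ℕP.+-comm m 2) room)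

  offsetsIn : ∀ {s a b} → s + a + b ≡ n → s ≤ m → b ≤ a → Offsets m s a b
  offsetsIn n≡ s≤m b≤a = offsets s≤m b≤a (subst (m + 2 ≤_) (sym n≡) room)

  remainder : ∀ {a★ b★} → n ∸ m ≡ a★ + b★ → (m + a★ + b★ ≡ n) × (n ∸ (m + a★) ≡ b★)
  remainder {a★} {b★} n∸m≡ = n≡ , trans (cong (_∸ (m + a★)) (sym n≡)) (ℕP.m+n∸m≡n (m + a★) b★)
    where
    n≡ : m + a★ + b★ ≡ n
    n≡ = trans (ℕP.+-assoc m a★ b★) (trans (cong (λ x → m + x) (sym n∸m≡)) (ℕP.m+[n∸m]≡n (ℕP.≤-trans (ℕP.m≤m+n m 2) room)))

  full-clique : ∀ {s a b} (o : Offsets m s a b) → Offsets.t o ≡ 0 → s ≡ m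
  full-clique {s} o t≡0 = sym (trans (Offsets.m≡s+t o) (trans (cong (λ x → s + x) t≡0) (ℕP.+-identityʳ s)))

  imbalance : ∀ {s a b} (o : Offsets m s a b) {e} → Offsets.d o ≡ e → a ≡ b + e
  imbalance o refl = Offsets.a≡b+d o

  fitting : ∀ {a★ b★} → n ∸ m ≡ a★ + b★ → m + a★ ≤ n
  fitting {a★} {b★} n∸m≡ = subst (m + a★ ≤_) (trans (cong (λ x → m + x) (sym n∸m≡)) (ℕP.m+[n∸m]≡n (ℕP.≤-trans (ℕP.m≤m+n m 2) room)))
    (ℕP.+-monoʳ-≤ m (ℕP.m≤m+n a★ b★))

  split-rest : ∀ {s a b} → s + a + b ≡ n → s ≡ m → n ∸ m ≡ a + b
  split-rest {a = a} {b} n≡ refl = n∸s {m} {a} {b} n≡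

even-sharp : ∀ {n m} → m + 2 ≤ n → (n ∸ m) % 2 ≡ 0 →
  SharpNumerator n m ((n ∸ m) / 2) (evenNumerator (+ n) (+ m))
even-sharp {n} {m} room even = record { excess = excess ; fits = fitting n∸m≡h+h ; attained = attained }
  where
  open ClassSizes room
  h = (n ∸ m) / 2
  n∸m≡h+h : n ∸ m ≡ h + h
  n∸m≡h+h = halve-even (n ∸ m) even

  excess : ∀ {s a b} → s + a + b ≡ n → s ≤ m → b ≤ a →
    Σ ℕ λ X → (evenNumerator (+ n) (+ m) ≡ + (4 * threeClassW (n ∸ 1) s a b + X)) × (X ≡ 0 → s ≡ m × a ≡ h)
  excess {s} {a} {b} n≡ s≤m b≤a = gap s t u d , Numerators.even-numerator n≡ o , vanishing
    where
    o = offsetsIn n≡ s≤m b≤a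
    open Offsets o
    vanishing : gap s t u d ≡ 0 → s ≡ m × a ≡ h
    vanishing g = s≡m , a≡h
      where
      s≡m = full-clique o (proj₁ (gap≡0 s t u d g))
      a≡b : a ≡ b
      a≡b = trans (imbalance o (proj₂ (gap≡0 s t u d g))) (ℕP.+-identityʳ b)
      a≡h : a ≡ h
      a≡h = sym (trans (cong (_/ 2) (trans (split-rest n≡ s≡m) (cong (λ x → a + x) (sym a≡b)))) (half-double a))

  attained : evenNumerator (+ n) (+ m) ≡ + (4 * threeClassW (n ∸ 1) m h (n ∸ (m + h)))
  attained = trans (Numerators.even-numerator n≡ (fullCliqueOffsets 0 (sym (ℕP.+-identityʳ h)) 2≤h+h))
    (cong +_ (trans (cong (λ g → 4 * threeClassW (n ∸ 1) m h h + g) (gap-balanced m (h + h ∸ 2)))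
             (trans (ℕP.+-identityʳ _) (cong (λ b → 4 * threeClassW (n ∸ 1) m h b) (sym rest)))))
    where
    n≡ = proj₁ (remainder n∸m≡h+h)
    rest = proj₂ (remainder n∸m≡h+h)
    2≤h+h = subst (2 ≤_) n∸m≡h+h 2≤n∸m

rearrange : ∀ {f g l x} → g ≡ l + x → f + g ≡ f + x + l
rearrange {f} {g} {l} {x} refl = shuffle f l x
  where
  shuffle : ∀ f l x → f + (l + x) ≡ f + x + l
  shuffle = ℕRing.solve-∀

module OddCase {n m : ℕ} (room : m + 2 ≤ n) (odd : (n ∸ m) % 2 ≡ 1) where
  open ClassSizes room

  h = (n ∸ m) / 2

  n∸m≡ : n ∸ m ≡ suc h + h
  n∸m≡ = halve-odd (n ∸ m) odd

  a★≡ : (n ∸ m + 1) / 2 ≡ suc h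
  a★≡ = trans (cong (λ x → (x + 1) / 2) n∸m≡) (half-double-suc h)

  -- For admissible class sizes, the odd excess is read off from `odd-excess`;
  -- d = t = 0 is excluded since it would make n - m = a + a even.
  excess : ∀ {s a b} → s + a + b ≡ n → s ≤ m → b ≤ a →
    Σ ℕ λ X → (oddNumerator (+ n) (+ m) ≡ + (4 * threeClassW (n ∸ 1) s a b + X)) × (X ≡ 0 → s ≡ m × a ≡ suc h)
  excess {s} {a} {b} n≡ s≤m b≤a = from-odd-excess (odd-excess s t u d parity)
    where
    o = offsetsIn n≡ s≤m b≤a
    open Offsets o
    parity : d ≡ 0 → t ≢ 0
    parity d≡0 t≡0 with () ← trans (sym odd) (trans (cong (_% 2) (trans (split-rest n≡ (full-clique o t≡0))
                               (cong (λ x → a + x) (sym (trans (imbalance o d≡0) (ℕP.+-identityʳ b))))))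
                               (double-even a))
    from-odd-excess : Σ ℕ (λ X → gap s t u d ≡ (imbalanceCost s t u + 3 * t) + X × (X ≡ 0 → t ≡ 0 × d ≡ 1)) →
      Σ ℕ λ X → (oddNumerator (+ n) (+ m) ≡ + (4 * threeClassW (n ∸ 1) s a b + X)) × (X ≡ 0 → s ≡ m × a ≡ suc h)
    from-odd-excess (X , gap≡ , vanish) = X , numerator≡ , vanishing
      where
      numerator≡ : oddNumerator (+ n) (+ m) ≡ + (4 * threeClassW (n ∸ 1) s a b + X)
      numerator≡ = pos-cancel _ _ (imbalanceCost s t u + 3 * t)
        (trans (Numerators.odd-numerator n≡ o)
               (trans (Numerators.even-numerator n≡ o) (cong +_ (rearrange {4 * threeClassW (n ∸ 1) s a b} gap≡))))
      vanishing : X ≡ 0 → s ≡ m × a ≡ suc h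
      vanishing X≡0 = s≡m , a≡
        where
        s≡m = full-clique o (proj₁ (vanish X≡0))
        a≡1+b : a ≡ suc b
        a≡1+b = trans (imbalance o (proj₂ (vanish X≡0))) (ℕP.+-comm b 1)
        a≡ : a ≡ suc h
        a≡ = trans (trans a≡1+b (sym (half-double-suc b)))
               (trans (cong (λ x → (x + 1) / 2) (sym (trans (split-rest n≡ s≡m) (cong (_+ b) a≡1+b)))) a★≡)

  -- At s = m, a = h + 1, b = h the gap is exactly the lowering.
  attained : oddNumerator (+ n) (+ m) ≡ + (4 * threeClassW (n ∸ 1) m (suc h) (n ∸ (m + suc h)))
  attained = pos-cancel _ _ (imbalanceCost m 0 u + 3 * 0)
    (trans (Numerators.odd-numerator n≡ o) (trans (Numerators.even-numerator n≡ o)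
      (cong +_ (cong₂ (λ b g → 4 * threeClassW (n ∸ 1) m (suc h) b + g) (sym rest) one-unit))))
    where
    n≡ = proj₁ (remainder n∸m≡)
    rest = proj₂ (remainder n∸m≡)
    u = suc h + h ∸ 2
    o = fullCliqueOffsets 1 (ℕP.+-comm 1 h) (subst (2 ≤_) n∸m≡ 2≤n∸m)
    one-unit : gap m 0 u 1 ≡ imbalanceCost m 0 u + 3 * 0
    one-unit = trans (ℕP.+-identityʳ _) (trans (ℕP.*-identityʳ _) (sym (ℕP.+-identityʳ _)))

odd-sharp : ∀ {n m} → m + 2 ≤ n → (n ∸ m) % 2 ≡ 1 →
  SharpNumerator n m ((n ∸ m + 1) / 2) (oddNumerator (+ n) (+ m))
odd-sharp {n} {m} room odd = subst (λ a★ → SharpNumerator n m a★ (oddNumerator (+ n) (+ m))) (sym a★≡)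
  record { excess = excess ; fits = ClassSizes.fitting room n∸m≡ ; attained = attained }
  where open OddCase room odd

joinClass : ℕ → ℕ → ℕ → Class
joinClass m a i = if i <ᵇ m then clique else (if i <ᵇ m + a then left else right)

code-joinClass : ∀ m a i → code (joinClass m a i) ≡ cls m a i
code-joinClass m a i with i <ᵇ m
... | true = refl
... | false with i <ᵇ m + a
...   | true = refl
...   | false = refl

sumBelow : ℕ → (ℕ → ℕ) → ℕ
sumBelow zero g = 0
sumBelow (suc n) g = g 0 + sumBelow n (g ∘ suc)

sum-toℕ : ∀ n (g : ℕ → ℕ) → sum {n} (g ∘ toℕ) ≡ sumBelow n g
sum-toℕ zero g = refl
sum-toℕ (suc n) g = cong (λ r → g 0 + r) (sum-toℕ n (g ∘ suc))

sumBelow-join : ∀ m a n (g : Class → ℕ) → m + a ≤ n →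
  sumBelow n (g ∘ joinClass m a) ≡ m * g clique + a * g left + (n ∸ (m + a)) * g right
sumBelow-join zero zero n g _ = constant n
  where
  constant : ∀ k → sumBelow k (λ _ → g right) ≡ 0 * g clique + 0 * g left + k * g right
  constant zero = refl
  constant (suc k) = cong (λ r → g right + r) (constant k)
sumBelow-join zero (suc a) (suc n) g (s≤s a≤n) =
  trans (cong (λ r → g left + r) (sumBelow-join zero a n g a≤n)) (shift (g clique) (g left) a ((n ∸ a) * g right))
  where
  shift : ∀ x y a z → y + (0 * x + a * y + z) ≡ 0 * x + (y + a * y) + z
  shift = ℕRing.solve-∀
sumBelow-join (suc m) a (suc n) g (s≤s m+a≤n) =
  trans (cong (λ r → g clique + r) (sumBelow-join m a n g m+a≤n)) (shift (g clique) m (a * g left) ((n ∸ (m + a)) * g right))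
  where
  shift : ∀ x m y z → x + (m * x + y + z) ≡ (x + m * x) + y + z
  shift = ℕRing.solve-∀

record Sized {n} (cl : Fin n → Class) (s a b : ℕ) : Set where
  constructor sized
  field
    cliqueSize : count cl clique ≡ s
    leftSize : count cl left ≡ a
    rightSize : count cl right ≡ b

same-sizes : ∀ {n} {f g : Fin n → Class} {s a b} → Sized f s a b → Sized g s a b → ∀ c → count f c ≡ count g c
same-sizes (sized f₀ f₁ f₂) (sized g₀ g₁ g₂) clique = trans f₀ (sym g₀)
same-sizes (sized f₀ f₁ f₂) (sized g₀ g₁ g₂) left = trans f₁ (sym g₁)
same-sizes (sized f₀ f₁ f₂) (sized g₀ g₁ g₂) right = trans f₂ (sym g₂)

join-sized : ∀ {n m a} → m + a ≤ n → Sized (joinClass m a ∘ toℕ {n}) m a (n ∸ (m + a))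
join-sized {n} {m} {a} m+a≤n =
  sized (trans (count-join clique) (pick₀ m a b)) (trans (count-join left) (pick₁ m a b)) (trans (count-join right) (pick₂ m a b))
  where
  b = n ∸ (m + a)
  count-join : ∀ c → count (joinClass m a ∘ toℕ {n}) c ≡ m * is c clique + a * is c left + b * is c right
  count-join c = trans (sum-toℕ n (is c ∘ joinClass m a)) (sumBelow-join m a n (is c) m+a≤n)
  pick₀ : ∀ x y z → x * 1 + y * 0 + z * 0 ≡ x
  pick₀ = ℕRing.solve-∀
  pick₁ : ∀ x y z → x * 0 + y * 1 + z * 0 ≡ y
  pick₁ = ℕRing.solve-∀
  pick₂ : ∀ x y z → x * 0 + y * 0 + z * 1 ≡ z
  pick₂ = ℕRing.solve-∀

_≟ᶜ_ : (c d : Class) → Dec (c ≡ d)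
clique ≟ᶜ clique = yes refl
left ≟ᶜ left = yes refl
right ≟ᶜ right = yes refl
clique ≟ᶜ left = no λ ()
clique ≟ᶜ right = no λ ()
left ≟ᶜ clique = no λ ()
left ≟ᶜ right = no λ ()
right ≟ᶜ clique = no λ ()
right ≟ᶜ left = no λ ()

is-self : ∀ c → is c c ≡ 1
is-self clique = refl
is-self left = refl
is-self right = refl

is-other : ∀ {c d} → c ≢ d → is c d ≡ 0
is-other {clique} {clique} c≢d = ⊥-elim (c≢d refl)
is-other {left} {left} c≢d = ⊥-elim (c≢d refl)
is-other {right} {right} c≢d = ⊥-elim (c≢d refl)
is-other {clique} {left} _ = refl
is-other {clique} {right} _ = refl
is-other {left} {clique} _ = refl
is-other {left} {right} _ = refl
is-other {right} {clique} _ = refl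
is-other {right} {left} _ = refl

member : ∀ {n} (g : Fin n → Class) c → 1 ≤ count g c → Σ (Fin n) λ y → g y ≡ c
member {suc n} g c nonempty with g fzero ≟ᶜ c
... | yes g0≡c = fzero , g0≡c
... | no g0≢c with member (g ∘ fsuc) c (subst (λ k → 1 ≤ k + count (g ∘ fsuc) c) (is-other (g0≢c ∘ sym)) nonempty)
...   | y , gy≡c = fsuc y , gy≡c

-- Class assignments with equal class sizes differ by a permutation of the
-- vertices: match the first vertex with a vertex of its class, and recurse.
matching-permutation : ∀ {n} (f g : Fin n → Class) → (∀ c → count f c ≡ count g c) →
  Σ (Permutation′ n) λ π → ∀ x → g (π ⟨$⟩ʳ x) ≡ f x
matching-permutation {zero} f g _ = Perm.id , λ ()
matching-permutation {suc n} f g same = insert fzero y (proj₁ rest) , matches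
  where
  c = f fzero
  partner = member g c (subst (1 ≤_) (same c) (subst (λ k → 1 ≤ k + count (f ∘ fsuc) c) (sym (is-self c)) (s≤s z≤n)))
  y = proj₁ partner
  gy≡c = proj₂ partner
  -- removing fzero from f and y from g keeps the class sizes equal
  same′ : ∀ d → count (f ∘ fsuc) d ≡ count (g ∘ punchIn y) d
  same′ d = ℕP.+-cancelˡ-≡ (is d c) _ _
    (trans (same d) (trans (sum-remove {i = y} (λ x → is d (g x))) (cong (λ e → is d e + count (g ∘ punchIn y) d) gy≡c)))
  rest = matching-permutation (f ∘ fsuc) (g ∘ punchIn y) same′
  matches : ∀ x → g (insert fzero y (proj₁ rest) ⟨$⟩ʳ x) ≡ f x
  matches fzero = gy≡c
  matches (fsuc x) = trans (cong g (insert-punchIn fzero y (proj₁ rest) x)) (proj₂ rest x)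

distinct-perm : ∀ {n} (π : Permutation′ n) x y → ⌊ π ⟨$⟩ʳ x ≟ π ⟨$⟩ʳ y ⌋ ≡ ⌊ x ≟ y ⌋
distinct-perm π x y with π ⟨$⟩ʳ x ≟ π ⟨$⟩ʳ y | x ≟ y
... | yes _ | yes _ = refl
... | no _ | no _ = refl
... | yes πx≡πy | no x≢y = ⊥-elim (x≢y (trans (sym (Perm.inverseˡ π)) (trans (cong (π ⟨$⟩ˡ_) πx≡πy) (Perm.inverseˡ π))))
... | no πx≢πy | yes refl = ⊥-elim (πx≢πy refl)

three-class⇒join : ∀ {n} (G : Graph n) (cl : Fin n → Class) m a → m + a ≤ n →
  (∀ x y → adj G x y ≡ classAdj cl x y) → Sized cl m a (n ∸ (m + a)) → G ≅ joinGraph n m a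
three-class⇒join {n} G cl m a m+a≤n G≡K sizes = record
  { to = π ⟨$⟩ʳ_
  ; from = π ⟨$⟩ˡ_
  ; from-to = λ _ → Perm.inverseˡ π
  ; to-from = λ _ → Perm.inverseʳ π
  ; pres = λ x y → trans (G≡K x y) (sym (cong₂ _∧_ (cong not (distinct-perm π x y)) (cong₂ crossAdj (class-of x) (class-of y)))) }
  where
  match = matching-permutation cl (joinClass m a ∘ toℕ) (same-sizes sizes (join-sized {n} {m} {a} m+a≤n))
  π = proj₁ match
  class-of : ∀ x → cls m a (toℕ (π ⟨$⟩ʳ x)) ≡ code (cl x)
  class-of x = trans (sym (code-joinClass m a _)) (cong code (proj₂ match x))

join⇒three-class : ∀ {n} (G : Graph n) m a → m + a ≤ n → G ≅ joinGraph n m a →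
  Σ (Fin n → Class) λ cl → (∀ x y → adj G x y ≡ classAdj cl x y) × Sized cl m a (n ∸ (m + a))
join⇒three-class {n} G m a m+a≤n iso = joinClass m a ∘ toℕ ∘ to , G≡K , sizes
  where
  open _≅_ iso
  π : Permutation′ n
  π = permutation to from to-from from-to
  G≡K : ∀ x y → adj G x y ≡ classAdj (joinClass m a ∘ toℕ ∘ to) x y
  G≡K x y = trans (pres x y) (cong₂ _∧_ (cong not (distinct-perm π x y))
                                     (sym (cong₂ crossAdj (code-joinClass m a _) (code-joinClass m a _))))
  permuted : ∀ c → count (joinClass m a ∘ toℕ ∘ to) c ≡ count (joinClass m a ∘ toℕ {n}) c
  permuted c = sym (sum-permute (λ z → is c (joinClass m a (toℕ z))) π)
  sizes : Sized (joinClass m a ∘ toℕ ∘ to) m a (n ∸ (m + a))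
  sizes = sized (trans (permuted clique) cliqueSize) (trans (permuted left) leftSize) (trans (permuted right) rightSize)
    where open Sized (join-sized {n} {m} {a} m+a≤n)

-- A clique vertex is adjacent to all others, so it is a common neighbour
-- of any two non-adjacent vertices: such graphs have diameter ≤ 2.
clique-common : ∀ {n} (G : Graph n) (cl : Fin n → Class) → (∀ x y → adj G x y ≡ classAdj cl x y) →
  ∀ z → cl z ≡ clique → CommonNeighbours G
clique-common G cl G≡K z z∈clique x y x≢y xy = z , to-z x x≢z , from-z y z≢y
  where
  cross-clique : ∀ c → crossAdj (code c) 0 ≡ true × crossAdj 0 (code c) ≡ true
  cross-clique clique = refl , refl
  cross-clique left = refl , refl
  cross-clique right = refl , refl
  to-z : ∀ u → u ≢ z → adj G u z ≡ true
  to-z u u≢z = trans (G≡K u z) (cong₂ _∧_ (distinct-≢ u≢z)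
                 (trans (cong (λ c → crossAdj (code (cl u)) (code c)) z∈clique) (proj₁ (cross-clique (cl u)))))
  from-z : ∀ v → z ≢ v → adj G z v ≡ true
  from-z v z≢v = trans (G≡K z v) (cong₂ _∧_ (distinct-≢ z≢v)
                 (trans (cong (λ c → crossAdj (code c) (code (cl v))) z∈clique) (proj₂ (cross-clique (cl v)))))
  x≢z : x ≢ z
  x≢z refl with () ← trans (sym (from-z y x≢y)) xy
  z≢y : z ≢ y
  z≢y refl with () ← trans (sym (to-z x x≢y)) xy

W-cong : ∀ {n} {A B : Fin n → Fin n → Bool} → (∀ x y → A x y ≡ B x y) → W A ≡ W B
W-cong A≡B = ℕP.≤-antisym (Monotone.W-mono (λ x y e → trans (sym (A≡B x y)) e))
                          (Monotone.W-mono (λ x y e → trans (A≡B x y) e))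

half≤eighth : ∀ {w f} x → w ≤ f → half w ≤ℚ + (4 * f + x) ℚ./ 8
half≤eighth {w} {f} x w≤f = /-mono-≤ (+ w) 1 (+ (4 * f + x)) 7
  (subst₂ ℤ._≤_ (ℤP.pos-* w 8) (ℤP.pos-* (4 * f + x) 2) (+≤+ (ℕP.≤-trans (ℕP.*-monoˡ-≤ 8 w≤f) (scale f x))))
  where
  scale : ∀ f x → f * 8 ≤ (4 * f + x) * 2
  scale f x = subst (f * 8 ≤_) (expand f x) (ℕP.m≤m+n (f * 8) (x * 2))
    where
    expand : ∀ f x → f * 8 + x * 2 ≡ (4 * f + x) * 2
    expand = ℕRing.solve-∀

eighth≤half : ∀ {w f} x → w ≤ f → + (4 * f + x) ℚ./ 8 ≤ℚ half w → x ≡ 0 × w ≡ f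
eighth≤half {w} {f} x w≤f le with /-cancel-≤ (+ (4 * f + x)) 7 (+ w) 1 le
... | cross with subst₂ ℤ._≤_ (sym (ℤP.pos-* (4 * f + x) 2)) (sym (ℤP.pos-* w 8)) cross
...   | +≤+ f≤w = x≡0 , ℕP.≤-antisym w≤f (ℕP.*-cancelʳ-≤ f w 8 (ℕP.≤-trans (ℕP.m≤m+n (f * 8) (x * 2)) bounded))
  where
  expand : ∀ f x → f * 8 + x * 2 ≡ (4 * f + x) * 2
  expand = ℕRing.solve-∀
  bounded : f * 8 + x * 2 ≤ w * 8
  bounded = subst (_≤ w * 8) (sym (expand f x)) f≤w
  x≡0 : x ≡ 0
  x≡0 with ℕP.m*n≡0⇒m≡0∨n≡0 x (ℕP.n≤0⇒n≡0 (ℕP.+-cancelˡ-≤ (f * 8) (x * 2) 0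
                 (subst (f * 8 + x * 2 ≤_) (sym (ℕP.+-identityʳ (f * 8))) (ℕP.≤-trans bounded (ℕP.*-monoˡ-≤ 8 w≤f)))))
  ... | inj₁ x≡0 = x≡0

half≡eighth : ∀ f → half f ≡ + (4 * f) ℚ./ 8
half≡eighth f = /-cong-cross (+ f) 1 (+ (4 * f)) 7
  (trans (sym (ℤP.pos-* f 8)) (trans (cong +_ (regroup f)) (ℤP.pos-* (4 * f) 2)))
  where
  regroup : ∀ f → f * 8 ≡ 4 * f * 2
  regroup = ℕRing.solve-∀

module SharpBound {n m a★ Z} (sharp : SharpNumerator n m a★ Z) (G : Graph n) where
  open SharpNumerator sharp

  module Covered (v₂G : v₂≤ G m) where
    open ClassCover (classCover G m v₂G)
    s = count classOf clique
    a = count classOf left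
    b = count classOf right

    W≤F : W (adj G) ≤ threeClassW (n ∸ 1) s a b
    W≤F = subst (W (adj G) ≤_) (W-classAdj classOf) (Monotone.W-mono covers)

    surplus = excess (class-sizes classOf) clique≤m right≤left
    X = proj₁ surplus
    Z≡ = proj₁ (proj₂ surplus)

    -- RDD ≤ W/2 ≤ F/2 ≤ (4F + X)/8 = Z/8.
    upper : RDD G ≤ℚ Z ℚ./ 8
    upper = ℚP.≤-trans (RDD≤halfW G) (subst (λ z → half (W (adj G)) ≤ℚ z ℚ./ 8) (sym Z≡) (half≤eighth X W≤F))

    -- Equality forces X = 0 and W(G) = W(K): G is the full three-class
    -- graph, and its class sizes are the extremal ones.
    extremal : RDD G ≡ Z ℚ./ 8 → G ≅ joinGraph n m a★
    extremal RDD≡ = three-class⇒join G classOf m a★ fits G≡K (sized s≡m a≡a★ b≡)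
      where
      tight = eighth≤half X W≤F
        (subst (λ z → z ℚ./ 8 ≤ℚ half (W (adj G))) Z≡ (subst (_≤ℚ half (W (adj G))) RDD≡ (RDD≤halfW G)))
      G≡K : ∀ x y → adj G x y ≡ classAdj classOf x y
      G≡K = Monotone.W-rigid covers (Graph.sym G) (classAdj-sym classOf) (classAdj-irrefl classOf)
              (trans (proj₂ tight) (sym (W-classAdj classOf)))
      s≡m = proj₁ (proj₂ (proj₂ surplus) (proj₁ tight))
      a≡a★ = proj₂ (proj₂ (proj₂ surplus) (proj₁ tight))
      b≡ : b ≡ n ∸ (m + a★)
      b≡ = sym (trans (cong₂ (λ s′ a′ → n ∸ (s′ + a′)) (sym s≡m) (sym a≡a★))
                      (trans (cong (_∸ (s + a)) (sym (class-sizes classOf))) (ℕP.m+n∸m≡n (s + a) b)))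

  -- The join graph has a clique vertex (as m ≥ 1), hence diameter 2, and
  -- its W is F(m, a★, n - m - a★); so it attains Z/8.
  attained-by-join : 1 ≤ m → G ≅ joinGraph n m a★ → RDD G ≡ Z ℚ./ 8
  attained-by-join 1≤m iso = begin
    RDD G                                                  ≡⟨ RDD≡halfW G (clique-common G cl G≡K z z∈clique) ⟩
    half (W (adj G))                                       ≡⟨ cong half (trans (W-cong G≡K) (W-classAdj cl)) ⟩
    half (threeClassW (n ∸ 1) (count cl clique) (count cl left) (count cl right))
      ≡⟨ cong half (cong₂ (λ s (ab : ℕ × ℕ) → threeClassW (n ∸ 1) s (proj₁ ab) (proj₂ ab)) cliqueSize (cong₂ _,_ leftSize rightSize)) ⟩
    half (threeClassW (n ∸ 1) m a★ (n ∸ (m + a★)))         ≡⟨ half≡eighth (threeClassW (n ∸ 1) m a★ (n ∸ (m + a★))) ⟩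
    + (4 * threeClassW (n ∸ 1) m a★ (n ∸ (m + a★))) ℚ./ 8  ≡⟨ cong (ℚ._/ 8) (sym attained) ⟩
    Z ℚ./ 8                                                ∎
    where
    open ≡-Reasoning
    join = join⇒three-class G m a★ fits iso
    cl = proj₁ join
    G≡K = proj₁ (proj₂ join)
    open Sized (proj₂ (proj₂ join))
    clique-vertex = member cl clique (subst (1 ≤_) (sym cliqueSize) 1≤m)
    z = proj₁ clique-vertex
    z∈clique = proj₂ clique-vertex

sharp-bound : ∀ {n m a★ Z} → SharpNumerator n m a★ Z → 1 ≤ m → (G : Graph n) → v₂≤ G m →
  (RDD G ≤ℚ Z ℚ./ 8) × (RDD G ≡ Z ℚ./ 8 ⇔ G ≅ joinGraph n m a★)
sharp-bound sharp 1≤m G v₂G = upper , mk⇔ extremal (attained-by-join 1≤m)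
  where
  open SharpBound sharp G
  open Covered v₂G

corollary4p3 : (n m : ℕ) → 1 ≤ m → m + 2 ≤ n →
    (G : Graph n) → Connected G → v₂≤ G m →
    ((n ∸ m) % 2 ≡ 0 →
        (RDD G ≤ℚ boundEven n m)
      × (RDD G ≡ boundEven n m ⇔ G ≅ joinGraph n m ((n ∸ m) / 2)))
    × ((n ∸ m) % 2 ≡ 1 →
        (RDD G ≤ℚ boundOdd n m)
      × (RDD G ≡ boundOdd n m ⇔ G ≅ joinGraph n m ((n ∸ m + 1) / 2)))
corollary4p3 n m 1≤m room G _ v₂G =
  (λ even → sharp-bound (even-sharp room even) 1≤m G v₂G) ,
  (λ odd → sharp-bound (odd-sharp room odd) 1≤m G v₂G)
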